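{- Let $A$ be a symmetric $n\times n$ integer matrix with even diagonal entries such that $$A\pmod 4=\mathrm{diag}\Big(r\begin{pmatrix}2&1\\1&2\end{pmatrix}, s\begin{pmatrix}0&1\\1&0\end{pmatrix}, t\begin{pmatrix}0&2\\2&0\end{pmatrix}, p(2), m(0)\Big)$$ for non-negative integers $r,s,t,p,m$. Then: (i) $m=\dim\overline V_{000}$; (ii) $2t+p+m=\dim\overline V_0$; (iii) $p\equiv\dim(\overline V_0/\overline V_{000})\pmod 2$; (iv) if $q(\overline V_0)=\{0\}$, then $r\equiv\mathrm{Arf}(q)\pmod 2$.
   Context: $V=\mathbb Z^n$, $\overline V=\mathbb Z^n/2\mathbb Z^n$, $(v,w)=v^TAw$; $q=q_A:\overline V\to\mathbb F_2$, $q(v)=(v,v)/2\bmod2$, with alternating bilinear form $\Omega(v,w)=(v,w)\bmod 2$. $V_0=\{v\in V:(v,w)\equiv0\pmod2\ \forall w\}$, $V_{000}=\{v\in V_0:(v,w)\equiv0\pmod4\ \forall w\}$, $\overline V_0=V_0/2V$, $\overline V_{000}=(V_{000}+2V)/2V$. Arf invariant: for a basis $e_1,f_1,\dots,e_k,f_k,h_1,\dots,h_l$ of $\overline V$ with $\Omega(e_i,f_j)=\delta_{ij}$ and all other values of $\Omega$ on basis pairs zero, if $q(\overline V_0)=\{0\}$ then $\mathrm{Arf}(q)=\sum_i q(e_i)q(f_i)\in\mathbb F_2$, independent of the basis. "$\pmod 4$" on matrices is entrywise reduction into $\{0,1,2,3\}$; $\mathrm{diag}(\dots)$ with multiplicities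 is the block diagonal matrix with the indicated numbers of copies of each block. -}

module Defs where

open import Data.Nat as ℕ using (ℕ; zero; suc; _%_)
open import Data.Integer as ℤ using (ℤ; +_)
open import Data.Integer.DivMod using (_%ℕ_; _/ℕ_)
open import Data.Integer.Divisibility as ℤD using ()
open import Data.Bool using (Bool; true; false; _xor_; _∧_; if_then_else_)
open import Data.Fin using (Fin; splitAt)
open import Data.Unit using (⊤)
open import Data.Sum using (inj₁; inj₂)
open import Data.List using (List; []; _∷_; _++_; replicate)
open import Data.Product using (Σ; _×_; ∃)
open import Relation.Binary.PropositionalEquality using (_≡_; _≢_)
import Data.Vec.Functional as VF

sumℕ : ∀ {k} → (Fin k → ℕ) → ℕ
sumℕ {zero}  f = 0
sumℕ {suc k} f = f Fin.zero ℕ.+ sumℕ (λ i → f (Fin.suc i))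

sumℤ : ∀ {k} → (Fin k → ℤ) → ℤ
sumℤ {zero}  f = + 0
sumℤ {suc k} f = f Data.Fin.zero ℤ.+ sumℤ (λ i → f (Data.Fin.suc i))

sum𝔽₂ : ∀ {k} → (Fin k → Bool) → Bool
sum𝔽₂ {zero}  f = false
sum𝔽₂ {suc k} f = f Data.Fin.zero xor sum𝔽₂ (λ i → f (Data.Fin.suc i))

Matrix : Set → ℕ → Set
Matrix A n = Fin n → Fin n → A

data Block : Set where
  B21 B01 B02 One2 One0 : Block

bsize : Block → ℕ
bsize B21  = 2
bsize B01  = 2
bsize B02  = 2
bsize One2 = 1
bsize One0 = 1

2x2 : ℕ → ℕ → Matrix ℕ 2
2x2 d o Fin.zero     Fin.zero     = d
2x2 d o (Fin.suc _)  (Fin.suc _)  = d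
2x2 d o Fin.zero     (Fin.suc _)  = o
2x2 d o (Fin.suc _)  Fin.zero     = o

bmat : (b : Block) → Matrix ℕ (bsize b)
bmat B21  = 2x2 2 1
bmat B01  = 2x2 0 1
bmat B02  = 2x2 0 2
bmat One2 = λ _ _ → 2
bmat One0 = λ _ _ → 0

size : List Block → ℕ
size []      = 0
size (b ∷ L) = bsize b ℕ.+ size L

blockDiag : (L : List Block) → Matrix ℕ (size L)
blockDiag []      ()
blockDiag (b ∷ L) i j with splitAt (bsize b) i | splitAt (bsize b) j
... | inj₁ a | inj₁ a′ = bmat b a a′
... | inj₂ c | inj₂ c′ = blockDiag L c c′
... | inj₁ _ | inj₂ _  = 0
... | inj₂ _ | inj₁ _  = 0

layout : ℕ → ℕ → ℕ → ℕ → ℕ → List Block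
layout r s t p m =
  replicate r B21 ++ replicate s B01 ++ replicate t B02 ++ replicate p One2 ++ replicate m One0

_mod4 : ∀ {n} → Matrix ℤ n → Matrix ℕ n
(A mod4) i j = A i j %ℕ 4

Symmetric : ∀ {n} → Matrix ℤ n → Set
Symmetric A = ∀ i j → A i j ≡ A j i

EvenDiagonal : ∀ {n} → Matrix ℤ n → Set
EvenDiagonal A = ∀ i → (+ 2) ℤD.∣ A i i

module Lattice {n : ℕ} (A : Matrix ℤ n) where

  V : Set
  V = Fin n → ℤ

  ⟨_,_⟩ : V → V → ℤ
  ⟨ v , w ⟩ = sumℤ (λ i → sumℤ (λ j → v i ℤ.* A i j ℤ.* w j))

  V₀ : V → Set
  V₀ v = ∀ w → (+ 2) ℤD.∣ ⟨ v , w ⟩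

  V₀₀₀ : V → Set
  V₀₀₀ v = V₀ v × (∀ w → (+ 4) ℤD.∣ ⟨ v , w ⟩)

  -- V̄ = 𝔽₂ⁿ, with 𝔽₂ = Bool (xor, ∧)
  V̄ : Set
  V̄ = Fin n → Bool

  _≈_ : V̄ → V̄ → Set
  x ≈ y = ∀ i → x i ≡ y i

  red : V → V̄
  red v i = v i %ℕ 2 ℕ.≡ᵇ 1

  lift : V̄ → V
  lift x i = if x i then + 1 else + 0

  -- V̄₀ = V₀/2V  and  V̄₀₀₀ = (V₀₀₀ + 2V)/2V, as subsets of V̄
  V̄₀ : V̄ → Set
  V̄₀ x = ∃ λ v → V₀ v × red v ≈ x

  V̄₀₀₀ : V̄ → Set
  V̄₀₀₀ x = ∃ λ v → V₀₀₀ v × red v ≈ x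

  q : V̄ → ℕ
  q x = (⟨ lift x , lift x ⟩ /ℕ 2) %ℕ 2

  Ω : V̄ → V̄ → ℕ
  Ω x y = ⟨ lift x , lift y ⟩ %ℕ 2

  comb : ∀ {k} → (Fin k → Bool) → (Fin k → V̄) → V̄
  comb c b j = sum𝔽₂ (λ i → c i ∧ b i j)

  zeroV : V̄
  zeroV _ = false

  Subspace : Set₁
  Subspace = V̄ → Set

  IsBasis : ∀ {k} → Subspace → (Fin k → V̄) → Set
  IsBasis W b = (∀ i → W (b i))
              × (∀ c → comb c b ≈ zeroV → ∀ i → c i ≡ false)
              × (∀ x → W x → ∃ λ c → comb c b ≈ x)

  IsDim : Subspace → ℕ → Set
  IsDim W k = Σ (Fin k → V̄) (IsBasis W)

  -- b maps to a basis of the quotient W/U  (U ⊆ W)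
  IsQuotBasis : ∀ {k} → Subspace → Subspace → (Fin k → V̄) → Set
  IsQuotBasis W U b = (∀ i → W (b i))
                    × (∀ c → U (comb c b) → ∀ i → c i ≡ false)
                    × (∀ x → W x → ∃ λ c → U (λ j → comb c b j xor x j))

  IsQuotDim : Subspace → Subspace → ℕ → Set
  IsQuotDim W U k = Σ (Fin k → V̄) (IsQuotBasis W U)

  Whole : Subspace
  Whole _ = ⊤

  SymplecticBasis : ∀ {k l} → (Fin k → V̄) → (Fin k → V̄) → (Fin l → V̄) → Set
  SymplecticBasis e f h =
      IsBasis Whole ((e VF.++ f) VF.++ h)
    × (∀ i j → i ≡ j → Ω (e i) (f j) ≡ 1)
    × (∀ i j → i ≢ j → Ω (e i) (f j) ≡ 0)
    × (∀ i j → i ≡ j → Ω (f i) (e j) ≡ 1)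
    × (∀ i j → i ≢ j → Ω (f i) (e j) ≡ 0)
    × (∀ i j → Ω (e i) (e j) ≡ 0)
    × (∀ i j → Ω (f i) (f j) ≡ 0)
    × (∀ i j → Ω (e i) (h j) ≡ 0)
    × (∀ i j → Ω (h j) (e i) ≡ 0)
    × (∀ i j → Ω (f i) (h j) ≡ 0)
    × (∀ i j → Ω (h j) (f i) ≡ 0)
    × (∀ i j → Ω (h i) (h j) ≡ 0)

  -- Σᵢ q(eᵢ) q(fᵢ) ∈ 𝔽₂ (the Arf invariant when q(V̄₀) = 0)
  arfSum : ∀ {k} → (Fin k → V̄) → (Fin k → V̄) → ℕ
  arfSum e f = sumℕ (λ i → q (e i) ℕ.* q (f i)) % 2

-- The form (v, w) = vᵀ A w is only used modulo 4, so A may be replaced by its block-diagonal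
-- normal form. There Ω and q split over the blocks, V̄₀ = rad Ω is spanned by the coordinates of
-- the blocks [[0,2],[2,0]], (2) and (0), and V̄₀₀₀ by those of the blocks (0); this gives (i), (ii),
-- and dim V̄₀/V̄₀₀₀ = 2t + p, hence (iii).
-- For (iv) the Gauss sum Σₓ (-1)^q(x) is evaluated twice. Blockwise it is (-2)^r 2^s 4^t 0^p 2^m;
-- in a symplectic basis e, f, h, where h spans rad Ω ⊆ V̄₀ so that q(h) = 0, it is 2^(k+l) (-1)^Arf(q).
-- The latter is nonzero, so p = 0, and comparing signs gives r ≡ Arf(q) mod 2.
module Submission where

module BlockDiagonalForms where
  import Algebra.Properties.CommutativeMonoid.Sum as CommutativeMonoidSum
  open import Data.Bool using (Bool; true; false; _xor_; _∧_; if_then_else_)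
  open import Data.Bool.Properties
    using (∧-zeroʳ; ∧-identityʳ; ∧-distribʳ-xor; xor-identityʳ; xor-same; xor-assoc; xor-∧-commutativeRing)
  open import Data.Fin using (Fin; zero; suc; _↑ˡ_; _↑ʳ_; splitAt; join; combine; funToFin; finToFun)
  open import Data.Fin.Patterns using (0F; 1F)
  open import Data.Fin.Permutation using (Permutation; permutation)
  open import Data.Fin.Properties
    using (suc-injective; join-splitAt; splitAt-↑ˡ; splitAt-↑ʳ; remQuot-combine; funToFin-finToFin; finToFun-funToFin)
  open import Data.Integer as ℤ using (ℤ; +_; _+_; _*_; -_; _-_; ∣_∣; _^_)
  open import Data.Integer.DivMod using (_%ℕ_; _/ℕ_; a≡a%ℕn+[a/ℕn]*n; n%ℕd<d)
  import Data.Integer.Divisibility as Unsigned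
  open import Data.Integer.Divisibility.Signed
    using (_∣_; divides; ∣ᵤ⇒∣; ∣⇒∣ᵤ; ∣m∣n⇒∣m+n; ∣m⇒∣-m; ∣n⇒∣m*n; ∣m⇒∣m*n; ∣-trans; *-cancelʳ-∣)
  import Data.Integer.Properties as ℤ
  open import Data.Integer.Tactic.RingSolver using (solve-∀)
  open import Data.List using (List; []; _∷_; _++_; replicate; map)
  open import Data.List.Properties using (map-++; map-replicate)
  open import Data.Maybe using (nothing)
  open import Data.Nat as ℕ using (ℕ; zero; suc; NonZero; _%_)
  import Data.Nat.Divisibility as ℕ
  import Data.Nat.DivMod as ℕ
  open import Data.Nat.ListAction using (sum)
  open import Data.Nat.ListAction.Properties using (sum-++)
  import Data.Nat.Properties as ℕ
  import Data.Nat.Tactic.RingSolver as ℕ-Solver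
  open import Data.Product using (Σ; ∃; _×_; _,_; proj₁; proj₂)
  open import Data.Sum using (inj₁; inj₂)
  open import Data.Unit using (⊤; tt)
  import Data.Vec.Functional as VF
  open import Data.Vec.Functional.Properties using (lookup-++ˡ; lookup-++ʳ; ++-cong)
  open import Function using (_∘_)
  open import Function.Definitions using (Congruent)
  open import Relation.Binary using (tri<; tri≈; tri>)
  open import Relation.Binary.PropositionalEquality
  open import Relation.Nullary using (contradiction)
  import Tactic.RingSolver as RingSolver
  open import Tactic.RingSolver.Core.AlmostCommutativeRing using (AlmostCommutativeRing; fromCommutativeRing)

  open import Defs

  infix 4 _≡_mod_

  record _≡_mod_ (a b : ℤ) (k : ℕ) : Set where
    constructor congruent
    field k∣a-b : + k ∣ a - b

  -- Opaque: otherwise checking the definitions below unfolds congruence proofs down to the ring-solver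
  -- equations inside them, which makes type checking very slow.
  private
    opaque
      by : ∀ {k a b x} → a - b ≡ x → + k ∣ x → a ≡ b mod k
      by refl = congruent

  ≡mod-reflexive : ∀ {k a b} → a ≡ b → a ≡ b mod k
  ≡mod-reflexive {a = a} a≡b = by (trans (cong (_-_ a) (sym a≡b)) (ℤ.+-inverseʳ a)) (divides (+ 0) refl)

  ≡mod-refl : ∀ {k} a → a ≡ a mod k
  ≡mod-refl a = ≡mod-reflexive refl

  ≡mod-sym : ∀ {k a b} → a ≡ b mod k → b ≡ a mod k
  ≡mod-sym {a = a} {b} (congruent k∣a-b) = by (negate a b) (∣m⇒∣-m k∣a-b)
    where
    negate : ∀ a b → b - a ≡ - (a - b)
    negate = solve-∀

  ≡mod-trans : ∀ {k a b c} → a ≡ b mod k → b ≡ c mod k → a ≡ c mod k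
  ≡mod-trans {a = a} {b} {c} (congruent p) (congruent q) = by (telescope a b c) (∣m∣n⇒∣m+n p q)
    where
    telescope : ∀ a b c → a - c ≡ (a - b) + (b - c)
    telescope = solve-∀

  ≡mod-+ : ∀ {k a b c d} → a ≡ b mod k → c ≡ d mod k → a + c ≡ b + d mod k
  ≡mod-+ {a = a} {b} {c} {d} (congruent p) (congruent q) = by (regroup a b c d) (∣m∣n⇒∣m+n p q)
    where
    regroup : ∀ a b c d → (a + c) - (b + d) ≡ (a - b) + (c - d)
    regroup = solve-∀

  ≡mod-* : ∀ {k a b c d} → a ≡ b mod k → c ≡ d mod k → a * c ≡ b * d mod k
  ≡mod-* {a = a} {b} {c} {d} (congruent p) (congruent q) =
    by (regroup a b c d) (∣m∣n⇒∣m+n (∣n⇒∣m*n a q) (∣m⇒∣m*n d p))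
    where
    regroup : ∀ a b c d → a * c - b * d ≡ a * (c - d) + (a - b) * d
    regroup = solve-∀

  ≡mod-from-≡ : ∀ {k a b} c → a ≡ b + c * + k → a ≡ b mod k
  ≡mod-from-≡ {k} {a} {b} c a≡b+ck = by (trans (cong (_- b) a≡b+ck) (cancel b c (+ k))) (divides c refl)
    where
    cancel : ∀ b c k → (b + c * k) - b ≡ c * k
    cancel = solve-∀

  multiple≡0mod : ∀ {k} b → b * + k ≡ + 0 mod k
  multiple≡0mod b = by (ℤ.+-identityʳ _) (divides b refl)

  %ℕ≡0⇒≡mod : ∀ {k} .{{_ : NonZero k}} {a b} → (a - b) %ℕ k ≡ 0 → a ≡ b mod k
  %ℕ≡0⇒≡mod {k} {a} {b} a-b%k≡0 =
    by (trans (a≡a%ℕn+[a/ℕn]*n (a - b) k) (cong (λ r → + r + (a - b) /ℕ k * + k) a-b%k≡0))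
       (divides ((a - b) /ℕ k) (ℤ.+-identityˡ _))

  ≡mod*⇒≡mod : ∀ {k d a b} → a ≡ b mod k ℕ.* d → a ≡ b mod k
  ≡mod*⇒≡mod {k} {d} (congruent p) = congruent (∣-trans (divides (+ d) (trans (ℤ.pos-* k d) (ℤ.*-comm (+ k) (+ d)))) p)

  ≡mod2⇒*2≡mod4 : ∀ {a b} → a ≡ b mod 2 → a * + 2 ≡ b * + 2 mod 4
  ≡mod2⇒*2≡mod4 {a} {b} (congruent (divides q a-b≡q2)) =
    by (trans (factor a b) (cong (_* + 2) a-b≡q2)) (divides q (regroup q))
    where
    factor : ∀ a b → a * + 2 - b * + 2 ≡ (a - b) * + 2
    factor = solve-∀
    regroup : ∀ q → q * + 2 * + 2 ≡ q * + 4
    regroup = solve-∀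

  *2≡mod4⇒≡mod2 : ∀ {a b} → a * + 2 ≡ b * + 2 mod 4 → a ≡ b mod 2
  *2≡mod4⇒≡mod2 {a} {b} (congruent 4∣2a-2b) = congruent (*-cancelʳ-∣ (+ 2) (subst (+ 4 ∣_) (factor a b) 4∣2a-2b))
    where
    factor : ∀ a b → a * + 2 - b * + 2 ≡ (a - b) * + 2
    factor = solve-∀

  ∣⇒≡0mod : ∀ {k a} → + k Unsigned.∣ a → a ≡ + 0 mod k
  ∣⇒≡0mod {a = a} k∣a = by (ℤ.+-identityʳ a) (∣ᵤ⇒∣ k∣a)

  ≡0mod⇒∣ : ∀ {k a} → a ≡ + 0 mod k → + k Unsigned.∣ a
  ≡0mod⇒∣ {a = a} (congruent k∣a) = ∣⇒∣ᵤ (subst (_ ∣_) (ℤ.+-identityʳ a) k∣a)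

  ≡mod-%ℕ : ∀ {k} .{{_ : NonZero k}} a → a ≡ + (a %ℕ k) mod k
  ≡mod-%ℕ {k} a =
    by (trans (cong (_- + (a %ℕ k)) (a≡a%ℕn+[a/ℕn]*n a k)) (cancel (+ (a %ℕ k)) (a /ℕ k * + k))) (divides (a /ℕ k) refl)
    where
    cancel : ∀ x y → (x + y) - x ≡ y
    cancel = solve-∀

  ∣∧<⇒≡0 : ∀ {k n} → k ℕ.∣ n → n ℕ.< k → n ≡ 0
  ∣∧<⇒≡0 {n = zero}  _   _   = refl
  ∣∧<⇒≡0 {n = suc n} k∣n n<k = contradiction k∣n (ℕ.>⇒∤ n<k)

  -- a %ℕ k and r are residues below k that differ by a multiple of k.
  %ℕ-unique : ∀ {k} .{{_ : NonZero k}} {a r} → r ℕ.< k → a ≡ + r mod k → a %ℕ k ≡ r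
  %ℕ-unique {k} {a} {r} r<k a≡r =
    ℤ.+-injective (ℤ.i-j≡0⇒i≡j _ _ (ℤ.∣i∣≡0⇒i≡0 (∣∧<⇒≡0 k∣distance distance<k)))
    where
    r′ = a %ℕ k
    k∣distance : k ℕ.∣ ∣ + r′ - + r ∣
    k∣distance = ∣⇒∣ᵤ (_≡_mod_.k∣a-b (≡mod-trans (≡mod-sym (≡mod-%ℕ a)) a≡r))
    distance<k : ∣ + r′ - + r ∣ ℕ.< k
    distance<k = ℕ.≤-<-trans (subst (ℕ._≤ r′ ℕ.⊔ r) (cong ∣_∣ (sym (ℤ.m-n≡m⊖n r′ r))) (ℤ.∣m⊝n∣≤m⊔n r′ r))
                             (ℕ.⊔-lub (n%ℕd<d a k) r<k)

  ≡*2mod4⇒/ℕ2≡mod2 : ∀ {X Y} → X ≡ Y * + 2 mod 4 → X /ℕ 2 ≡ Y mod 2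
  ≡*2mod4⇒/ℕ2≡mod2 {X} {Y} (congruent 4∣X-2Y) = congruent (*-cancelʳ-∣ (+ 2) (subst (+ 4 ∣_) X-2Y≡ 4∣X-2Y))
    where
    X%2≡0 : X %ℕ 2 ≡ 0
    X%2≡0 = %ℕ-unique {2} {X} (ℕ.s≤s ℕ.z≤n)
              (≡mod-trans (≡mod*⇒≡mod {2} {2} {X} (congruent 4∣X-2Y)) (multiple≡0mod Y))
    X-2Y≡ : X - Y * + 2 ≡ (X /ℕ 2 - Y) * + 2
    X-2Y≡ = trans (cong (_- Y * + 2) (trans (a≡a%ℕn+[a/ℕn]*n X 2) (cong (λ r → + r + X /ℕ 2 * + 2) X%2≡0)))
                  (factor (X /ℕ 2) Y)
      where
      factor : ∀ H Y → (+ 0 + H * + 2) - Y * + 2 ≡ (H - Y) * + 2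
      factor = solve-∀

  sumℤ-cong : ∀ {n} {f g : Fin n → ℤ} → f ≗ g → sumℤ f ≡ sumℤ g
  sumℤ-cong {zero}  f≗g = refl
  sumℤ-cong {suc n} f≗g = cong₂ _+_ (f≗g zero) (sumℤ-cong (f≗g ∘ suc))

  sumℤ-zero : ∀ {n} (f : Fin n → ℤ) → f ≗ (λ _ → + 0) → sumℤ f ≡ + 0
  sumℤ-zero {zero}  f f≗0 = refl
  sumℤ-zero {suc n} f f≗0 = cong₂ _+_ (f≗0 zero) (sumℤ-zero (f ∘ suc) (f≗0 ∘ suc))

  sumℤ-++ : ∀ m {n} (f : Fin (m ℕ.+ n) → ℤ) → sumℤ f ≡ sumℤ (VF.take m f) + sumℤ (VF.drop m f)
  sumℤ-++ zero    f = sym (ℤ.+-identityˡ _)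
  sumℤ-++ (suc m) f = trans (cong (_+_ (f zero)) (sumℤ-++ m (f ∘ suc))) (sym (ℤ.+-assoc (f zero) _ _))

  sumℤ≗≡mod : ∀ {n k} {f g : Fin n → ℤ} → (∀ i → f i ≡ g i mod k) → sumℤ f ≡ sumℤ g mod k
  sumℤ≗≡mod {zero}  f≡g = ≡mod-refl _
  sumℤ≗≡mod {suc n} f≡g = ≡mod-+ (f≡g zero) (sumℤ≗≡mod (f≡g ∘ suc))

  sumℕ-cong : ∀ {n} {f g : Fin n → ℕ} → f ≗ g → sumℕ f ≡ sumℕ g
  sumℕ-cong {zero}  f≗g = refl
  sumℕ-cong {suc n} f≗g = cong₂ ℕ._+_ (f≗g zero) (sumℕ-cong (f≗g ∘ suc))

  sumℕ-++ : ∀ m {n} (f : Fin (m ℕ.+ n) → ℕ) → sumℕ f ≡ sumℕ (VF.take m f) ℕ.+ sumℕ (VF.drop m f)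
  sumℕ-++ zero    f = refl
  sumℕ-++ (suc m) f = trans (cong (f zero ℕ.+_) (sumℕ-++ m (f ∘ suc))) (sym (ℕ.+-assoc (f zero) _ _))

  Bits : ℕ → Set
  Bits n = Fin n → Bool

  ι : Bool → ℤ
  ι b = if b then + 1 else + 0

  bit : Bool → ℕ
  bit b = if b then 1 else 0

  bit<2 : ∀ b → bit b ℕ.< 2
  bit<2 false = ℕ.s≤s ℕ.z≤n
  bit<2 true  = ℕ.s≤s (ℕ.s≤s ℕ.z≤n)

  ι≡+bit : ∀ b → ι b ≡ + bit b
  ι≡+bit false = refl
  ι≡+bit true  = refl

  bit≡0⇒false : ∀ {u} → bit u ≡ 0 → u ≡ false
  bit≡0⇒false {false} _ = refl

  bit≡1⇒true : ∀ {u} → bit u ≡ 1 → u ≡ true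
  bit≡1⇒true {true} _ = refl

  bit-∧ : ∀ a b → bit a ℕ.* bit b ≡ bit (a ∧ b)
  bit-∧ false b = refl
  bit-∧ true  b = ℕ.+-identityʳ (bit b)

  ι-∧ : ∀ a b → ι (a ∧ b) ≡ ι a * ι b
  ι-∧ false b = refl
  ι-∧ true  b = sym (ℤ.*-identityˡ (ι b))

  ι-xor : ∀ a b → ι (a xor b) ≡ ι a + ι b mod 2
  ι-xor false false = ≡mod-refl _
  ι-xor false true  = ≡mod-refl _
  ι-xor true  false = ≡mod-refl _
  ι-xor true  true  = ≡mod-sym (multiple≡0mod (+ 1))

  ι-residue : ∀ {r} → r ℕ.< 2 → + r ≡ ι (r ℕ.≡ᵇ 1)
  ι-residue {0} _ = refl
  ι-residue {1} _ = refl
  ι-residue {suc (suc r)} (ℕ.s≤s (ℕ.s≤s ()))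

  red-ι : ∀ b → ((ι b %ℕ 2) ℕ.≡ᵇ 1) ≡ b
  red-ι false = refl
  red-ι true  = refl

  %ℕ2≡bit : ∀ {X u} → X ≡ ι u mod 2 → X %ℕ 2 ≡ bit u
  %ℕ2≡bit {u = u} X≡u = %ℕ-unique (bit<2 u) (subst (_ ≡_mod 2) (ι≡+bit u) X≡u)

  /ℕ2%ℕ2≡bit : ∀ {X u} → X ≡ ι u * + 2 mod 4 → (X /ℕ 2) %ℕ 2 ≡ bit u
  /ℕ2%ℕ2≡bit X≡2u = %ℕ2≡bit (≡*2mod4⇒/ℕ2≡mod2 X≡2u)

  odd : ℕ → Bool
  odd 0             = false
  odd 1             = true
  odd (suc (suc n)) = odd n

  %2≡bit∘odd : ∀ n → n % 2 ≡ bit (odd n)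
  %2≡bit∘odd 0             = refl
  %2≡bit∘odd 1             = refl
  %2≡bit∘odd (suc (suc n)) = trans (cong (_% 2) (ℕ.+-comm 2 n)) (trans (ℕ.[m+n]%n≡m%n n 2) (%2≡bit∘odd n))

  -- For the ring solver, which does not know that 1 + 1 = 0 in 𝔽₂.
  𝔽₂ : AlmostCommutativeRing _ _
  𝔽₂ = fromCommutativeRing xor-∧-commutativeRing (λ _ → nothing)

  infixr 5 _⊕_

  _⊕_ : ∀ {n} → Bits n → Bits n → Bits n
  (x ⊕ y) i = x i xor y i

  0ᵇ : ∀ {n} → Bits n
  0ᵇ _ = false

  xor≡false⇒≡ : ∀ {a b} → a xor b ≡ false → a ≡ b
  xor≡false⇒≡ {false} {false} _ = refl
  xor≡false⇒≡ {true}  {true}  _ = refl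

  ↑-cases : ∀ {m n} (P : Fin (m ℕ.+ n) → Set) → (∀ i → P (i ↑ˡ n)) → (∀ j → P (m ↑ʳ j)) → ∀ i → P i
  ↑-cases {m} {n} P left right i = subst P (join-splitAt m n i) (by-side (splitAt m i))
    where
    by-side : ∀ s → P (join m n s)
    by-side (inj₁ i) = left i
    by-side (inj₂ j) = right j

  sum𝔽₂-cong : ∀ {n} {f g : Bits n} → f ≗ g → sum𝔽₂ f ≡ sum𝔽₂ g
  sum𝔽₂-cong {zero}  f≗g = refl
  sum𝔽₂-cong {suc n} f≗g = cong₂ _xor_ (f≗g zero) (sum𝔽₂-cong (f≗g ∘ suc))

  sum𝔽₂-zero : ∀ {n} (f : Bits n) → f ≗ 0ᵇ → sum𝔽₂ f ≡ false
  sum𝔽₂-zero {zero}  f f≗0 = refl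
  sum𝔽₂-zero {suc n} f f≗0 = cong₂ _xor_ (f≗0 zero) (sum𝔽₂-zero (f ∘ suc) (f≗0 ∘ suc))

  sum𝔽₂-⊕ : ∀ {n} (f g : Bits n) → sum𝔽₂ (f ⊕ g) ≡ sum𝔽₂ f xor sum𝔽₂ g
  sum𝔽₂-⊕ {zero}  f g = refl
  sum𝔽₂-⊕ {suc n} f g = trans (cong ((f zero xor g zero) xor_) (sum𝔽₂-⊕ (f ∘ suc) (g ∘ suc)))
                              (interchange (f zero) (g zero) (sum𝔽₂ (f ∘ suc)) (sum𝔽₂ (g ∘ suc)))
    where
    interchange : ∀ a b c d → (a xor b) xor (c xor d) ≡ (a xor c) xor (b xor d)
    interchange = RingSolver.solve-∀ 𝔽₂

  sum𝔽₂-++ : ∀ m {n} (f : Bits (m ℕ.+ n)) → sum𝔽₂ f ≡ sum𝔽₂ (VF.take m f) xor sum𝔽₂ (VF.drop m f)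
  sum𝔽₂-++ zero    f = refl
  sum𝔽₂-++ (suc m) f = trans (cong (f zero xor_) (sum𝔽₂-++ m (f ∘ suc))) (sym (xor-assoc (f zero) _ _))

  sum𝔽₂-δ : ∀ {n} (f : Bits n) i → (∀ j → j ≢ i → f j ≡ false) → sum𝔽₂ f ≡ f i
  sum𝔽₂-δ f zero    f≡0 = trans (cong (f zero xor_) (sum𝔽₂-zero (f ∘ suc) (λ j → f≡0 (suc j) (λ ())))) (xor-identityʳ _)
  sum𝔽₂-δ f (suc i) f≡0 rewrite f≡0 zero (λ ()) = sum𝔽₂-δ (f ∘ suc) i (λ j j≢i → f≡0 (suc j) (j≢i ∘ suc-injective))

  sumℕ-bit-%2 : ∀ {n} (g : Bits n) → sumℕ (bit ∘ g) % 2 ≡ bit (sum𝔽₂ g)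
  sumℕ-bit-%2 {zero}  g = refl
  sumℕ-bit-%2 {suc n} g = trans (ℕ.%-distribˡ-+ (bit (g zero)) (sumℕ (bit ∘ g ∘ suc)) 2)
    (trans (cong (λ r → (bit (g zero) % 2 ℕ.+ r) % 2) (sumℕ-bit-%2 (g ∘ suc))) (add (g zero) (sum𝔽₂ (g ∘ suc))))
    where
    add : ∀ a b → (bit a % 2 ℕ.+ bit b) % 2 ≡ bit (a xor b)
    add false false = refl
    add false true  = refl
    add true  false = refl
    add true  true  = refl

  -- lincomb, Basis and QuotientBasis unfold to comb, IsBasis and IsQuotBasis of Lattice A.
  lincomb : ∀ {k n} → Bits k → (Fin k → Bits n) → Bits n
  lincomb c b j = sum𝔽₂ (λ i → c i ∧ b i j)

  Independent : ∀ {k n} → (Fin k → Bits n) → Set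
  Independent b = ∀ c → lincomb c b ≗ 0ᵇ → ∀ i → c i ≡ false

  Spans : ∀ {k n} → (Bits n → Set) → (Fin k → Bits n) → Set
  Spans W b = ∀ x → W x → ∃ λ c → lincomb c b ≗ x

  Basis : ∀ {k n} → (Bits n → Set) → (Fin k → Bits n) → Set
  Basis W b = (∀ i → W (b i)) × Independent b × Spans W b

  QuotientBasis : ∀ {k n} → (Bits n → Set) → (Bits n → Set) → (Fin k → Bits n) → Set
  QuotientBasis W U b = (∀ i → W (b i))
                      × (∀ c → U (lincomb c b) → ∀ i → c i ≡ false)
                      × (∀ x → W x → ∃ λ c → U (lincomb c b ⊕ x))

  Basis-transfer : ∀ {k n} {W W′ : Bits n → Set} {b : Fin k → Bits n} →
                   (∀ {x} → W x → W′ x) → (∀ {x} → W′ x → W x) → Basis W b → Basis W′ b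
  Basis-transfer W⇒W′ W′⇒W (inside , independent , spans) = W⇒W′ ∘ inside , independent , λ x → spans x ∘ W′⇒W

  QuotientBasis-transfer : ∀ {k n} {W W′ U U′ : Bits n → Set} {b : Fin k → Bits n} →
                           (∀ {x} → W x → W′ x) → (∀ {x} → W′ x → W x) → (∀ {x} → U x → U′ x) → (∀ {x} → U′ x → U x) →
                           QuotientBasis W U b → QuotientBasis W′ U′ b
  QuotientBasis-transfer {b = b} W⇒W′ W′⇒W U⇒U′ U′⇒U (inside , independent , spans) =
    W⇒W′ ∘ inside , (λ c → independent c ∘ U′⇒U {lincomb c b}) ,
    λ x x∈W′ → let c , r = spans x (W′⇒W x∈W′) in c , U⇒U′ {lincomb c b ⊕ x} r

  lincomb-cong : ∀ {k n} {c c′ : Bits k} (b : Fin k → Bits n) → c ≗ c′ → lincomb c b ≗ lincomb c′ b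
  lincomb-cong b c≗c′ j = sum𝔽₂-cong (λ i → cong (_∧ b i j) (c≗c′ i))

  lincomb-⊕ : ∀ {k n} (c c′ : Bits k) (b : Fin k → Bits n) → lincomb (c ⊕ c′) b ≗ lincomb c b ⊕ lincomb c′ b
  lincomb-⊕ c c′ b j =
    trans (sum𝔽₂-cong (λ i → ∧-distribʳ-xor (b i j) (c i) (c′ i))) (sum𝔽₂-⊕ (λ i → c i ∧ b i j) (λ i → c′ i ∧ b i j))

  lincomb-0ᵇ : ∀ {k n} (b : Fin k → Bits n) → lincomb 0ᵇ b ≗ 0ᵇ
  lincomb-0ᵇ b j = sum𝔽₂-zero (λ i → false ∧ b i j) (λ _ → refl)

  lincomb-++ : ∀ {k₁ k₂ n} (c : Bits (k₁ ℕ.+ k₂)) (b₁ : Fin k₁ → Bits n) (b₂ : Fin k₂ → Bits n) →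
               lincomb c (b₁ VF.++ b₂) ≗ lincomb (VF.take k₁ c) b₁ ⊕ lincomb (VF.drop k₁ c) b₂
  lincomb-++ {k₁} c b₁ b₂ j = trans (sum𝔽₂-++ k₁ _) (cong₂ _xor_
    (sum𝔽₂-cong (λ i → cong (λ v → VF.take k₁ c i ∧ v j) (lookup-++ˡ b₁ b₂ i)))
    (sum𝔽₂-cong (λ i → cong (λ v → VF.drop k₁ c i ∧ v j) (lookup-++ʳ b₁ b₂ i))))

  lincomb-injective : ∀ {k n} {b : Fin k → Bits n} → Independent b →
                      ∀ {c c′} → lincomb c b ≗ lincomb c′ b → c ≗ c′
  lincomb-injective {b = b} independent {c} {c′} same i = xor≡false⇒≡ (independent (c ⊕ c′) c⊕c′·b≡0 i)
    where
    c⊕c′·b≡0 : lincomb (c ⊕ c′) b ≗ 0ᵇ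
    c⊕c′·b≡0 j = trans (lincomb-⊕ c c′ b j) (trans (cong (_xor lincomb c′ b j) (same j)) (xor-same (lincomb c′ b j)))

  SupportedOn : ∀ {n} → Bits n → Bits n → Set
  SupportedOn M x = ∀ j → M j ≡ false → x j ≡ false

  SupportedOn-cong : ∀ {n} {M x y : Bits n} → x ≗ y → SupportedOn M x → SupportedOn M y
  SupportedOn-cong x≗y x∈M j Mj≡false = trans (sym (x≗y j)) (x∈M j Mj≡false)

  SupportedOn-lincomb : ∀ {k n} {M : Bits n} {b : Fin k → Bits n} → (∀ i → SupportedOn M (b i)) →
                        ∀ c → SupportedOn M (lincomb c b)
  SupportedOn-lincomb b∈M c j Mj≡false = sum𝔽₂-zero _ (λ i → trans (cong (c i ∧_) (b∈M i j Mj≡false)) (∧-zeroʳ (c i)))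

  SupportedOn-++ : ∀ {m n} {M₁ : Bits m} {M₂ : Bits n} {x : Bits (m ℕ.+ n)} →
                   SupportedOn M₁ (VF.take m x) → SupportedOn M₂ (VF.drop m x) → SupportedOn (M₁ VF.++ M₂) x
  SupportedOn-++ {M₁ = M₁} {M₂} x₁∈M₁ x₂∈M₂ = ↑-cases _
    (λ i → x₁∈M₁ i ∘ trans (sym (lookup-++ˡ M₁ M₂ i)))
    (λ j → x₂∈M₂ j ∘ trans (sym (lookup-++ʳ M₁ M₂ j)))

  SupportedOn-take : ∀ {m n} {M₁ : Bits m} {M₂ : Bits n} {x : Bits (m ℕ.+ n)} →
                     SupportedOn (M₁ VF.++ M₂) x → SupportedOn M₁ (VF.take m x)
  SupportedOn-take {M₁ = M₁} {M₂} x∈M i = x∈M _ ∘ trans (lookup-++ˡ M₁ M₂ i)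

  SupportedOn-drop : ∀ {m n} {M₁ : Bits m} {M₂ : Bits n} {x : Bits (m ℕ.+ n)} →
                     SupportedOn (M₁ VF.++ M₂) x → SupportedOn M₂ (VF.drop m x)
  SupportedOn-drop {M₁ = M₁} {M₂} x∈M j = x∈M _ ∘ trans (lookup-++ʳ M₁ M₂ j)

  count : ∀ {n} → Bits n → ℕ
  count M = sumℕ (bit ∘ M)

  count-++ : ∀ {m n} (M₁ : Bits m) (M₂ : Bits n) → count (M₁ VF.++ M₂) ≡ count M₁ ℕ.+ count M₂
  count-++ {m} M₁ M₂ = trans (sumℕ-++ m (bit ∘ (M₁ VF.++ M₂)))
    (cong₂ ℕ._+_ (sumℕ-cong (cong bit ∘ lookup-++ˡ M₁ M₂)) (sumℕ-cong (cong bit ∘ lookup-++ʳ M₁ M₂)))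

  coordinateBasis : ∀ {n} (M : Bits n) → Σ (Fin (count M) → Bits n) (Basis (SupportedOn M))
  coordinateBasis {zero}  M = (λ ()) , (λ ()) , (λ _ _ ()) , (λ _ _ → 0ᵇ , λ ())
  coordinateBasis {suc n} M with M zero in M₀ | coordinateBasis (M ∘ suc)
  ... | false | b , inside , independent , spans = b′ , inside′ , independent′ , spans′
    where
    b′ : Fin (count (M ∘ suc)) → Bits (suc n)
    b′ i = false VF.∷ b i
    inside′ : ∀ i → SupportedOn M (b′ i)
    inside′ i zero    _ = refl
    inside′ i (suc j) = inside i j
    independent′ : Independent b′
    independent′ c c·b′≡0 = independent c (c·b′≡0 ∘ suc)
    spans′ : Spans (SupportedOn M) b′
    spans′ x x∈M with spans (x ∘ suc) (x∈M ∘ suc)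
    ... | c , c·b≡x = c , λ { zero → trans (sum𝔽₂-zero _ (∧-zeroʳ ∘ c)) (sym (x∈M zero M₀)) ; (suc j) → c·b≡x j }
  ... | true  | b , inside , independent , spans = b′ , inside′ , independent′ , spans′
    where
    b′ : Fin (suc (count (M ∘ suc))) → Bits (suc n)
    b′ = (true VF.∷ 0ᵇ) VF.∷ λ i → false VF.∷ b i
    head-coefficient : ∀ c → lincomb c b′ zero ≡ c zero
    head-coefficient c = trans (cong ((c zero ∧ true) xor_) (sum𝔽₂-zero _ (λ i → ∧-zeroʳ (c (suc i))))) 
                               (trans (xor-identityʳ _) (∧-identityʳ _))
    tail-coefficients : ∀ c j → lincomb c b′ (suc j) ≡ lincomb (c ∘ suc) b j
    tail-coefficients c j = cong (_xor lincomb (c ∘ suc) b j) (∧-zeroʳ (c zero))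
    inside′ : ∀ i → SupportedOn M (b′ i)
    inside′ zero    zero    M₀≡false = trans (sym M₀) M₀≡false
    inside′ zero    (suc j) _ = refl
    inside′ (suc i) zero    _ = refl
    inside′ (suc i) (suc j) = inside i j
    independent′ : Independent b′
    independent′ c c·b′≡0 zero    = trans (sym (head-coefficient c)) (c·b′≡0 zero)
    independent′ c c·b′≡0 (suc i) = independent (c ∘ suc) (λ j → trans (sym (tail-coefficients c j)) (c·b′≡0 (suc j))) i
    spans′ : Spans (SupportedOn M) b′
    spans′ x x∈M with spans (x ∘ suc) (x∈M ∘ suc)
    ... | c , c·b≡x = (x zero VF.∷ c) , λ { zero → head-coefficient (x zero VF.∷ c)
                                          ; (suc j) → trans (tail-coefficients (x zero VF.∷ c) j) (c·b≡x j) }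

  QuotientBasis-++ : ∀ {d K n} {M M′ : Bits n} {bq : Fin d → Bits n} {b : Fin K → Bits n} →
                     (∀ x → SupportedOn M′ x → SupportedOn M x) →
                     QuotientBasis (SupportedOn M) (SupportedOn M′) bq → Basis (SupportedOn M′) b →
                     Basis (SupportedOn M) (bq VF.++ b)
  QuotientBasis-++ {d} {K} {bq = bq} {b} U⊆W (bq∈W , q-independent , q-spans) (b∈U , independent , spans) =
    inside , independent′ , spans′
    where
    inside : ∀ i → SupportedOn _ ((bq VF.++ b) i)
    inside = ↑-cases _ (λ i → subst (SupportedOn _) (sym (lookup-++ˡ bq b i)) (bq∈W i))
                       (λ j → subst (SupportedOn _) (sym (lookup-++ʳ bq b j)) (U⊆W _ (b∈U j)))
    independent′ : Independent (bq VF.++ b)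
    independent′ c c·b≡0 = ↑-cases _ take-c≡0 drop-c≡0
      where
      same : lincomb (VF.take d c) bq ≗ lincomb (VF.drop d c) b
      same j = xor≡false⇒≡ (trans (sym (lincomb-++ c bq b j)) (c·b≡0 j))
      take-c≡0 : ∀ i → VF.take d c i ≡ false
      take-c≡0 = q-independent _ (SupportedOn-cong (sym ∘ same) (SupportedOn-lincomb b∈U (VF.drop d c)))
      drop-c≡0 : ∀ j → VF.drop d c j ≡ false
      drop-c≡0 = independent _ λ j → trans (sym (same j)) (trans (lincomb-cong bq take-c≡0 j) (lincomb-0ᵇ bq j))
    spans′ : Spans (SupportedOn _) (bq VF.++ b)
    spans′ x x∈W with q-spans x x∈W
    ... | c₁ , x₁∈U with spans _ x₁∈U
    ... | c₂ , c₂·b≡x₁ = (c₁ VF.++ c₂) , λ j → begin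
      lincomb (c₁ VF.++ c₂) (bq VF.++ b) j
        ≡⟨ lincomb-++ (c₁ VF.++ c₂) bq b j ⟩
      lincomb (VF.take d (c₁ VF.++ c₂)) bq j xor lincomb (VF.drop d (c₁ VF.++ c₂)) b j
        ≡⟨ cong₂ _xor_ (lincomb-cong bq (lookup-++ˡ c₁ c₂) j) (lincomb-cong b (lookup-++ʳ c₁ c₂) j) ⟩
      lincomb c₁ bq j xor lincomb c₂ b j
        ≡⟨ cong (lincomb c₁ bq j xor_) (c₂·b≡x₁ j) ⟩
      lincomb c₁ bq j xor (lincomb c₁ bq j xor x j)
        ≡⟨ cancel (lincomb c₁ bq j) (x j) ⟩
      x j ∎
      where
      open ≡-Reasoning
      cancel : ∀ a b → a xor (a xor b) ≡ b
      cancel a b = trans (sym (xor-assoc a a b)) (cong (_xor b) (xor-same a))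

  sumBits : ∀ {n} → (Bits n → ℤ) → ℤ
  sumBits {zero}  F = F VF.[]
  sumBits {suc n} F = sumBits (F ∘ (false VF.∷_)) + sumBits (F ∘ (true VF.∷_))

  ∷-cong : ∀ {n} {A : Set} {F : Bits (suc n) → A} → Congruent _≗_ _≡_ F → ∀ b → Congruent _≗_ _≡_ (F ∘ (b VF.∷_))
  ∷-cong F-cong b x≗y = F-cong λ { zero → refl ; (suc i) → x≗y i }

  -- Sums over 𝔽₂ⁿ are moved to Fin (2 ^ n), where the library proves invariance under permutations.
  module _ where
    private
      toFin2 : Bool → Fin 2
      toFin2 false = 0F
      toFin2 true  = 1F

      fromFin2 : Fin 2 → Bool
      fromFin2 0F = false
      fromFin2 1F = true

      encode : ∀ {n} → Bits n → Fin (2 ℕ.^ n)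
      encode x = funToFin (toFin2 ∘ x)

      decode : ∀ {n} → Fin (2 ℕ.^ n) → Bits n
      decode i = fromFin2 ∘ finToFun i

      funToFin-cong : ∀ {m} {f g : Fin m → Fin 2} → f ≗ g → funToFin f ≡ funToFin g
      funToFin-cong {zero}  f≗g = refl
      funToFin-cong {suc m} f≗g = cong₂ combine (f≗g zero) (funToFin-cong (f≗g ∘ suc))

      encode-cong : ∀ {n} {x y : Bits n} → x ≗ y → encode x ≡ encode y
      encode-cong x≗y = funToFin-cong (cong toFin2 ∘ x≗y)

      decode-encode : ∀ {n} (x : Bits n) → decode (encode x) ≗ x
      decode-encode x i = trans (cong fromFin2 (finToFun-funToFin (toFin2 ∘ x) i)) (from-to (x i))
        where
        from-to : ∀ b → fromFin2 (toFin2 b) ≡ b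
        from-to false = refl
        from-to true  = refl

      encode-decode : ∀ {n} (i : Fin (2 ℕ.^ n)) → encode {n} (decode i) ≡ i
      encode-decode {n} i = trans (funToFin-cong {n} (to-from ∘ finToFun i)) (funToFin-finToFin {n} i)
        where
        to-from : ∀ i → toFin2 (fromFin2 i) ≡ i
        to-from 0F = refl
        to-from 1F = refl

      decode-combine : ∀ {n} (a : Fin 2) (i : Fin (2 ℕ.^ n)) → decode {suc n} (combine a i) ≗ fromFin2 a VF.∷ decode i
      decode-combine {n} a i zero    = cong (fromFin2 ∘ proj₁) (remQuot-combine {k = 2 ℕ.^ n} a i)
      decode-combine {n} a i (suc j) = cong (λ p → fromFin2 (finToFun (proj₂ p) j)) (remQuot-combine {k = 2 ℕ.^ n} a i)

      sumBits≡sumℤ∘decode : ∀ {n} (F : Bits n → ℤ) → Congruent _≗_ _≡_ F → sumBits F ≡ sumℤ (F ∘ decode {n})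
      sumBits≡sumℤ∘decode {zero}  F F-cong = trans (F-cong (λ ())) (sym (ℤ.+-identityʳ _))
      sumBits≡sumℤ∘decode {suc n} F F-cong = begin
        sumBits (F ∘ (false VF.∷_)) + sumBits (F ∘ (true VF.∷_))
          ≡⟨ cong₂ _+_ (sumBits≡sumℤ∘decode _ (∷-cong F-cong false)) (sumBits≡sumℤ∘decode _ (∷-cong F-cong true)) ⟩
        sumℤ (λ i → F (false VF.∷ decode i)) + sumℤ (λ i → F (true VF.∷ decode i))
          ≡⟨ cong₂ _+_ (sumℤ-cong (λ i → F-cong (sym ∘ decode-combine 0F i)))
                       (trans (sumℤ-cong (λ i → F-cong (sym ∘ decode-combine 1F i))) (sym (ℤ.+-identityʳ _))) ⟩
        sumℤ (VF.take N (F ∘ decode)) + (sumℤ (VF.take N (VF.drop N (F ∘ decode))) + + 0)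
          ≡⟨ cong (_+_ (sumℤ (VF.take N (F ∘ decode)))) (sym (sumℤ-++ N (VF.drop N (F ∘ decode {suc n})))) ⟩
        sumℤ (VF.take N (F ∘ decode)) + sumℤ (VF.drop N (F ∘ decode))
          ≡⟨ sym (sumℤ-++ N (F ∘ decode)) ⟩
        sumℤ (F ∘ decode) ∎
        where
        open ≡-Reasoning
        N = 2 ℕ.^ n

      module ∑ = CommutativeMonoidSum ℤ.+-0-commutativeMonoid

      sumℤ≡∑ : ∀ {n} (f : Fin n → ℤ) → sumℤ f ≡ ∑.sum f
      sumℤ≡∑ {zero}  f = refl
      sumℤ≡∑ {suc n} f = cong (_+_ (f zero)) (sumℤ≡∑ (f ∘ suc))

    sumBits-bijection : ∀ {K N} {φ : Bits K → Bits N} {ψ : Bits N → Bits K} →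
                        Congruent _≗_ _≗_ φ → Congruent _≗_ _≗_ ψ →
                        (∀ x → ψ (φ x) ≗ x) → (∀ y → φ (ψ y) ≗ y) →
                        (F : Bits N → ℤ) → Congruent _≗_ _≡_ F → sumBits F ≡ sumBits (F ∘ φ)
    sumBits-bijection {K} {N} {φ} {ψ} φ-cong ψ-cong ψφ φψ F F-cong = begin
      sumBits F                  ≡⟨ sumBits≡sumℤ∘decode F F-cong ⟩
      sumℤ (F ∘ decode)          ≡⟨ sumℤ≡∑ (F ∘ decode) ⟩
      ∑.sum (F ∘ decode)         ≡⟨ ∑.sum-permute (F ∘ decode) π ⟩
      ∑.sum (F ∘ decode ∘ φ̂)     ≡⟨ sumℤ≡∑ (F ∘ decode ∘ φ̂) ⟨
      sumℤ (F ∘ decode ∘ φ̂)      ≡⟨ sumℤ-cong (F-cong ∘ decode-encode ∘ φ ∘ decode) ⟩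
      sumℤ (F ∘ φ ∘ decode)      ≡⟨ sumBits≡sumℤ∘decode (F ∘ φ) (F-cong ∘ φ-cong) ⟨
      sumBits (F ∘ φ)            ∎
      where
      open ≡-Reasoning
      φ̂ : Fin (2 ℕ.^ K) → Fin (2 ℕ.^ N)
      φ̂ = encode ∘ φ ∘ decode
      ψ̂ : Fin (2 ℕ.^ N) → Fin (2 ℕ.^ K)
      ψ̂ = encode ∘ ψ ∘ decode
      π : Permutation (2 ℕ.^ K) (2 ℕ.^ N)
      π = permutation φ̂ ψ̂
        (λ i → trans (encode-cong (λ j → trans (φ-cong (decode-encode (ψ (decode i))) j) (φψ (decode i) j))) (encode-decode {N} i))
        (λ i → trans (encode-cong (λ j → trans (ψ-cong (decode-encode (φ (decode i))) j) (ψφ (decode i) j))) (encode-decode {K} i))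

  sumBits-cong : ∀ {n} {F G : Bits n → ℤ} → (∀ x → F x ≡ G x) → sumBits F ≡ sumBits G
  sumBits-cong {zero}  F≡G = F≡G VF.[]
  sumBits-cong {suc n} F≡G = cong₂ _+_ (sumBits-cong (F≡G ∘ (false VF.∷_))) (sumBits-cong (F≡G ∘ (true VF.∷_)))

  sumBits-*ˡ : ∀ {n} c (F : Bits n → ℤ) → sumBits (λ x → c * F x) ≡ c * sumBits F
  sumBits-*ˡ {zero}  c F = refl
  sumBits-*ˡ {suc n} c F =
    trans (cong₂ _+_ (sumBits-*ˡ c (F ∘ (false VF.∷_))) (sumBits-*ˡ c (F ∘ (true VF.∷_)))) (sym (ℤ.*-distribˡ-+ c _ _))

  sumBits-*ʳ : ∀ {n} (F : Bits n → ℤ) c → sumBits (λ x → F x * c) ≡ sumBits F * c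
  sumBits-*ʳ {n} F c = trans (sumBits-cong {n} (λ x → ℤ.*-comm (F x) c)) (trans (sumBits-*ˡ c F) (ℤ.*-comm c (sumBits F)))

  sumBits-+ : ∀ {n} (F G : Bits n → ℤ) → sumBits (λ x → F x + G x) ≡ sumBits F + sumBits G
  sumBits-+ {zero}  F G = refl
  sumBits-+ {suc n} F G =
    trans (cong₂ _+_ (sumBits-+ (F ∘ (false VF.∷_)) (G ∘ (false VF.∷_))) (sumBits-+ (F ∘ (true VF.∷_)) (G ∘ (true VF.∷_))))
          (interchange (sumBits (F ∘ (false VF.∷_))) _ _ _)
    where
    interchange : ∀ a b c d → (a + b) + (c + d) ≡ (a + c) + (b + d)
    interchange = solve-∀

  sumBits-1 : ∀ n → sumBits {n} (λ _ → + 1) ≡ + (2 ℕ.^ n)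
  sumBits-1 zero    = refl
  sumBits-1 (suc n) = trans (cong₂ _+_ (sumBits-1 n) (sumBits-1 n))
                            (trans (sym (ℤ.pos-+ (2 ℕ.^ n) _)) (cong (λ m → + (2 ℕ.^ n ℕ.+ m)) (sym (ℕ.+-identityʳ _))))

  sumBits-const : ∀ n c → sumBits {n} (λ _ → c) ≡ + (2 ℕ.^ n) * c
  sumBits-const n c = begin
    sumBits {n} (λ _ → c)       ≡⟨ sumBits-cong {n} (λ _ → sym (ℤ.*-identityʳ c)) ⟩
    sumBits {n} (λ _ → c * + 1) ≡⟨ sumBits-*ˡ {n} c (λ _ → + 1) ⟩
    c * sumBits {n} (λ _ → + 1) ≡⟨ cong (c *_) (sumBits-1 n) ⟩
    c * + (2 ℕ.^ n)             ≡⟨ ℤ.*-comm c _ ⟩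
    + (2 ℕ.^ n) * c             ∎
    where open ≡-Reasoning

  sumBits-++ : ∀ m {n} (F : Bits (m ℕ.+ n) → ℤ) → Congruent _≗_ _≡_ F →
               sumBits F ≡ sumBits {m} (λ u → sumBits {n} (λ w → F (u VF.++ w)))
  sumBits-++ zero    {n} F F-cong = sumBits-cong {n} (λ w → F-cong {w} {VF.[] VF.++ w} (λ _ → refl))
  sumBits-++ (suc m) {n} F F-cong = cong₂ _+_ (first-bit false) (first-bit true)
    where
    ∷-++ : ∀ {m n} b (u : Bits m) (w : Bits n) → b VF.∷ (u VF.++ w) ≗ (b VF.∷ u) VF.++ w
    ∷-++ b u w zero    = refl
    ∷-++ {m} b u w (suc i) with splitAt m i
    ... | inj₁ _ = refl
    ... | inj₂ _ = refl
    first-bit : ∀ b → sumBits (F ∘ (b VF.∷_)) ≡ sumBits {m} (λ u → sumBits {n} (λ w → F ((b VF.∷ u) VF.++ w)))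
    first-bit b = trans (sumBits-++ m (F ∘ (b VF.∷_)) (∷-cong F-cong b))
                        (sumBits-cong {m} (λ u → sumBits-cong {n} (λ w → F-cong (∷-++ b u w))))

  2^-injective : ∀ {m n} → 2 ℕ.^ m ≡ 2 ℕ.^ n → m ≡ n
  2^-injective {m} {n} eq with ℕ.<-cmp m n
  ... | tri< m<n _ _ = contradiction eq (ℕ.<⇒≢ (ℕ.^-monoʳ-< 2 (ℕ.s≤s (ℕ.s≤s ℕ.z≤n)) m<n))
  ... | tri≈ _ m≡n _ = m≡n
  ... | tri> _ _ m>n = contradiction (sym eq) (ℕ.<⇒≢ (ℕ.^-monoʳ-< 2 (ℕ.s≤s (ℕ.s≤s ℕ.z≤n)) m>n))

  -- Coordinates with respect to two bases identify Bits K with Bits K′, so 2 ^ K = 2 ^ K′.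
  basis-size-unique : ∀ {K K′ n} {M : Bits n} {b : Fin K → Bits n} {b′ : Fin K′ → Bits n} →
                      Basis (SupportedOn M) b → Basis (SupportedOn M) b′ → K ≡ K′
  basis-size-unique {K} {K′} {b = b} {b′} (b∈M , independent , spans) (b′∈M , independent′ , spans′) =
    2^-injective (ℤ.+-injective (begin
      + (2 ℕ.^ K)               ≡⟨ sumBits-1 K ⟨
      sumBits {K} (λ _ → + 1)    ≡⟨ sumBits-bijection ψ-cong φ-cong φψ ψφ (λ _ → + 1) (λ _ → refl) ⟩
      sumBits {K′} (λ _ → + 1)   ≡⟨ sumBits-1 K′ ⟩
      + (2 ℕ.^ K′)              ∎))
    where
    open ≡-Reasoning
    φ : Bits K → Bits K′
    φ c = proj₁ (spans′ (lincomb c b) (SupportedOn-lincomb b∈M c))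
    ψ : Bits K′ → Bits K
    ψ c = proj₁ (spans (lincomb c b′) (SupportedOn-lincomb b′∈M c))
    φ-coords : ∀ c → lincomb (φ c) b′ ≗ lincomb c b
    φ-coords c = proj₂ (spans′ (lincomb c b) (SupportedOn-lincomb b∈M c))
    ψ-coords : ∀ c → lincomb (ψ c) b ≗ lincomb c b′
    ψ-coords c = proj₂ (spans (lincomb c b′) (SupportedOn-lincomb b′∈M c))
    φ-cong : Congruent _≗_ _≗_ φ
    φ-cong {c} {c′} c≗c′ = lincomb-injective independent′ λ j →
      trans (φ-coords c j) (trans (lincomb-cong b c≗c′ j) (sym (φ-coords c′ j)))
    ψ-cong : Congruent _≗_ _≗_ ψ
    ψ-cong {c} {c′} c≗c′ = lincomb-injective independent λ j →
      trans (ψ-coords c j) (trans (lincomb-cong b′ c≗c′ j) (sym (ψ-coords c′ j)))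
    ψφ : ∀ c → ψ (φ c) ≗ c
    ψφ c = lincomb-injective independent λ j → trans (ψ-coords (φ c) j) (φ-coords c j)
    φψ : ∀ c → φ (ψ c) ≗ c
    φψ c = lincomb-injective independent′ λ j → trans (φ-coords (ψ c) j) (ψ-coords c j)

  sg : Bool → ℤ
  sg false = + 1
  sg true  = - + 1

  sg-xor : ∀ a b → sg (a xor b) ≡ sg a * sg b
  sg-xor false false = refl
  sg-xor false true  = refl
  sg-xor true  false = refl
  sg-xor true  true  = refl

  gauss : ∀ {n} → (Bits n → Bool) → ℤ
  gauss Q = sumBits (sg ∘ Q)

  -- Σ aᵢ uᵢ + bᵢ vᵢ + aᵢ bᵢ: the quadratic form on k hyperbolic planes with q(eᵢ) = uᵢ and q(fᵢ) = vᵢ.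
  hyperbolicQuadratic : ∀ {k} → Bits k → Bits k → Bits k → Bits k → Bool
  hyperbolicQuadratic u v a b = sum𝔽₂ (λ i → ((a i ∧ u i) xor (b i ∧ v i)) xor (a i ∧ b i))

  -- The Gauss sum factors over the hyperbolic planes; each plane contributes 2 (-1)^(u v).
  gauss-hyperbolic : ∀ {k} (u v : Bits k) →
                     sumBits (λ a → sumBits (λ b → sg (hyperbolicQuadratic u v a b))) ≡ + (2 ℕ.^ k) * sg (sum𝔽₂ (λ i → u i ∧ v i))
  gauss-hyperbolic {zero}  u v = refl
  gauss-hyperbolic {suc k} u v = begin
    row false + row true
      ≡⟨ cong₂ _+_ (row≡ false) (row≡ true) ⟩
    (sg (g false false) + sg (g false true)) * S′ + (sg (g true false) + sg (g true true)) * S′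
      ≡⟨ ℤ.*-distribʳ-+ S′ (sg (g false false) + sg (g false true)) (sg (g true false) + sg (g true true)) ⟨
    ((sg (g false false) + sg (g false true)) + (sg (g true false) + sg (g true true))) * S′
      ≡⟨ cong₂ _*_ (plane (u zero) (v zero)) (gauss-hyperbolic (u ∘ suc) (v ∘ suc)) ⟩
    (+ 2 * sg (u zero ∧ v zero)) * (+ (2 ℕ.^ k) * sg r)
      ≡⟨ regroup (sg (u zero ∧ v zero)) (+ (2 ℕ.^ k)) (sg r) ⟩
    (+ 2 * + (2 ℕ.^ k)) * (sg (u zero ∧ v zero) * sg r)
      ≡⟨ cong₂ _*_ (ℤ.pos-* 2 (2 ℕ.^ k)) (sg-xor (u zero ∧ v zero) r) ⟨
    + (2 ℕ.^ suc k) * sg (sum𝔽₂ (λ i → u i ∧ v i)) ∎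
    where
    open ≡-Reasoning
    g : Bool → Bool → Bool
    g α β = ((α ∧ u zero) xor (β ∧ v zero)) xor (α ∧ β)
    r = sum𝔽₂ (λ i → u (suc i) ∧ v (suc i))
    T′ : Bits k → ℤ
    T′ a′ = sumBits (λ b′ → sg (hyperbolicQuadratic (u ∘ suc) (v ∘ suc) a′ b′))
    S′ = sumBits T′
    row : Bool → ℤ
    row α = sumBits (λ a′ → sumBits {suc k} (λ b → sg (hyperbolicQuadratic u v (α VF.∷ a′) b)))
    column : ∀ α β a′ → sumBits (λ b′ → sg (hyperbolicQuadratic u v (α VF.∷ a′) (β VF.∷ b′))) ≡ sg (g α β) * T′ a′
    column α β a′ = trans (sumBits-cong (λ b′ → sg-xor (g α β) (hyperbolicQuadratic (u ∘ suc) (v ∘ suc) a′ b′)))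
                          (sumBits-*ˡ (sg (g α β)) (λ b′ → sg (hyperbolicQuadratic (u ∘ suc) (v ∘ suc) a′ b′)))
    row≡ : ∀ α → row α ≡ (sg (g α false) + sg (g α true)) * S′
    row≡ α = begin
      sumBits (λ a′ → sumBits (λ b′ → sg (hyperbolicQuadratic u v (α VF.∷ a′) (false VF.∷ b′)))
                    + sumBits (λ b′ → sg (hyperbolicQuadratic u v (α VF.∷ a′) (true VF.∷ b′))))
        ≡⟨ sumBits-cong (λ a′ → cong₂ _+_ (column α false a′) (column α true a′)) ⟩
      sumBits (λ a′ → sg (g α false) * T′ a′ + sg (g α true) * T′ a′)
        ≡⟨ sumBits-+ (λ a′ → sg (g α false) * T′ a′) (λ a′ → sg (g α true) * T′ a′) ⟩
      sumBits (λ a′ → sg (g α false) * T′ a′) + sumBits (λ a′ → sg (g α true) * T′ a′)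
        ≡⟨ cong₂ _+_ (sumBits-*ˡ (sg (g α false)) T′) (sumBits-*ˡ (sg (g α true)) T′) ⟩
      sg (g α false) * S′ + sg (g α true) * S′
        ≡⟨ ℤ.*-distribʳ-+ S′ (sg (g α false)) (sg (g α true)) ⟨
      (sg (g α false) + sg (g α true)) * S′ ∎
    plane : ∀ p q → let G α β = ((α ∧ p) xor (β ∧ q)) xor (α ∧ β) in
            (sg (G false false) + sg (G false true)) + (sg (G true false) + sg (G true true)) ≡ + 2 * sg (p ∧ q)
    plane false false = refl
    plane false true  = refl
    plane true  false = refl
    plane true  true  = refl
    regroup : ∀ s a t → (+ 2 * s) * (a * t) ≡ (+ 2 * a) * (s * t)
    regroup = solve-∀

  record IsQuadraticForm {n} (Q : Bits n → Bool) (B : Bits n → Bits n → Bool) : Set where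
    field
      Q-cong : Congruent _≗_ _≡_ Q
      B-cong : ∀ {x x′ y y′} → x ≗ x′ → y ≗ y′ → B x y ≡ B x′ y′
      B-sym  : ∀ x y → B x y ≡ B y x
      B-⊕ˡ   : ∀ x y z → B (x ⊕ y) z ≡ B x z xor B y z
      Q-⊕    : ∀ x y → Q (x ⊕ y) ≡ (Q x xor Q y) xor B x y

  module QuadraticForm {n} {Q : Bits n → Bool} {B : Bits n → Bits n → Bool} (isQF : IsQuadraticForm Q B) where
    open IsQuadraticForm isQF

    B-0ᵇˡ : ∀ z → B 0ᵇ z ≡ false
    B-0ᵇˡ z = self-inverse (B-⊕ˡ 0ᵇ 0ᵇ z)
      where
      self-inverse : ∀ {a} → a ≡ a xor a → a ≡ false
      self-inverse {a} eq = trans eq (xor-same a)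

    B-0ᵇʳ : ∀ z → B z 0ᵇ ≡ false
    B-0ᵇʳ z = trans (B-sym z 0ᵇ) (B-0ᵇˡ z)

    B-∧ˡ : ∀ a x z → B (λ j → a ∧ x j) z ≡ a ∧ B x z
    B-∧ˡ false x z = B-0ᵇˡ z
    B-∧ˡ true  x z = refl

    B-lincombˡ : ∀ {k} (c : Bits k) (b : Fin k → Bits n) z → B (lincomb c b) z ≡ sum𝔽₂ (λ i → c i ∧ B (b i) z)
    B-lincombˡ {zero}  c b z = B-0ᵇˡ z
    B-lincombˡ {suc k} c b z = begin
      B (lincomb c b) z
        ≡⟨ B-⊕ˡ (λ j → c zero ∧ b zero j) (lincomb (c ∘ suc) (b ∘ suc)) z ⟩
      B (λ j → c zero ∧ b zero j) z xor B (lincomb (c ∘ suc) (b ∘ suc)) z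
        ≡⟨ cong₂ _xor_ (B-∧ˡ (c zero) (b zero) z) (B-lincombˡ (c ∘ suc) (b ∘ suc) z) ⟩
      sum𝔽₂ (λ i → c i ∧ B (b i) z) ∎
      where open ≡-Reasoning

    Q-∧ : ∀ a x → Q (λ j → a ∧ x j) ≡ a ∧ Q x
    Q-∧ false x = trans (Q-⊕ 0ᵇ 0ᵇ) (trans (cong (_xor B 0ᵇ 0ᵇ) (xor-same (Q 0ᵇ))) (B-0ᵇˡ 0ᵇ))
    Q-∧ true  x = refl

    Q-lincomb : ∀ {k} (c : Bits k) (b : Fin k → Bits n) → (∀ i j → B (b i) (b j) ≡ false) →
                Q (lincomb c b) ≡ sum𝔽₂ (λ i → c i ∧ Q (b i))
    Q-lincomb {zero}  c b orthogonal = Q-∧ false (λ _ → false)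
    Q-lincomb {suc k} c b orthogonal = begin
      Q (lincomb c b)
        ≡⟨ Q-⊕ (λ j → c zero ∧ b zero j) rest ⟩
      (Q (λ j → c zero ∧ b zero j) xor Q rest) xor B (λ j → c zero ∧ b zero j) rest
        ≡⟨ cong₂ _xor_ (cong₂ _xor_ (Q-∧ (c zero) (b zero)) (Q-lincomb (c ∘ suc) (b ∘ suc) (λ i j → orthogonal (suc i) (suc j))))
                       cross-term ⟩
      ((c zero ∧ Q (b zero)) xor sum𝔽₂ (λ i → c (suc i) ∧ Q (b (suc i)))) xor false
        ≡⟨ xor-identityʳ _ ⟩
      sum𝔽₂ (λ i → c i ∧ Q (b i)) ∎
      where
      open ≡-Reasoning
      rest = lincomb (c ∘ suc) (b ∘ suc)
      cross-term : B (λ j → c zero ∧ b zero j) rest ≡ false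
      cross-term = begin
        B (λ j → c zero ∧ b zero j) rest                       ≡⟨ B-∧ˡ (c zero) (b zero) rest ⟩
        c zero ∧ B (b zero) rest                              ≡⟨ cong (c zero ∧_) (B-sym (b zero) rest) ⟩
        c zero ∧ B rest (b zero)                              ≡⟨ cong (c zero ∧_) (B-lincombˡ (c ∘ suc) (b ∘ suc) (b zero)) ⟩
        c zero ∧ sum𝔽₂ (λ i → c (suc i) ∧ B (b (suc i)) (b zero)) ≡⟨ cong (c zero ∧_) (sum𝔽₂-zero _ λ i →
                                                                      trans (cong (c (suc i) ∧_) (orthogonal (suc i) zero)) (∧-zeroʳ _)) ⟩
        c zero ∧ false                                        ≡⟨ ∧-zeroʳ (c zero) ⟩
        false                                                 ∎

    record IsSymplecticBasis {k l} (e f : Fin k → Bits n) (h : Fin l → Bits n) : Set where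
      field
        basis    : Basis (λ _ → ⊤) ((e VF.++ f) VF.++ h)
        B-ee     : ∀ i j → B (e i) (e j) ≡ false
        B-ff     : ∀ i j → B (f i) (f j) ≡ false
        B-fe-≡   : ∀ i j → i ≡ j → B (f i) (e j) ≡ true
        B-fe-≢   : ∀ i j → i ≢ j → B (f i) (e j) ≡ false
        B-he     : ∀ i j → B (h j) (e i) ≡ false
        B-hf     : ∀ i j → B (h j) (f i) ≡ false
        B-hh     : ∀ i j → B (h i) (h j) ≡ false

    module Symplectic {k l} {e f : Fin k → Bits n} {h : Fin l → Bits n} (symplectic : IsSymplecticBasis e f h) where
      open IsSymplecticBasis symplectic

      private
        bs : Fin ((k ℕ.+ k) ℕ.+ l) → Bits n
        bs = (e VF.++ f) VF.++ h

      coordinates : Bits n → Bits ((k ℕ.+ k) ℕ.+ l)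
      coordinates y = proj₁ (proj₂ (proj₂ basis) y tt)

      lincomb-coordinates : ∀ y → lincomb (coordinates y) bs ≗ y
      lincomb-coordinates y = proj₂ (proj₂ (proj₂ basis) y tt)

      coordinates-lincomb : ∀ c → coordinates (lincomb c bs) ≗ c
      coordinates-lincomb c = lincomb-injective (proj₁ (proj₂ basis)) (lincomb-coordinates (lincomb c bs))

      coordinates-cong : Congruent _≗_ _≗_ coordinates
      coordinates-cong {y} {y′} y≗y′ = lincomb-injective (proj₁ (proj₂ basis)) λ j →
        trans (lincomb-coordinates y j) (trans (y≗y′ j) (sym (lincomb-coordinates y′ j)))

      h-radical : ∀ j y → B (h j) y ≡ false
      h-radical j y = begin
        B (h j) y                                        ≡⟨ B-cong (λ _ → refl) (sym ∘ lincomb-coordinates y) ⟩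
        B (h j) (lincomb (coordinates y) bs)             ≡⟨ B-sym (h j) _ ⟩
        B (lincomb (coordinates y) bs) (h j)             ≡⟨ B-lincombˡ (coordinates y) bs (h j) ⟩
        sum𝔽₂ (λ i → coordinates y i ∧ B (bs i) (h j))   ≡⟨ sum𝔽₂-zero _ (λ i → trans (cong (coordinates y i ∧_)
                                                             (trans (B-sym (bs i) (h j)) (h-orthogonal i))) (∧-zeroʳ _)) ⟩
        false                                            ∎
        where
        open ≡-Reasoning
        h-orthogonal : ∀ i → B (h j) (bs i) ≡ false
        h-orthogonal = ↑-cases _
          (↑-cases _ (λ i → trans (cong (B (h j)) (trans (lookup-++ˡ (e VF.++ f) h _) (lookup-++ˡ e f i))) (B-he i j))
                     (λ i → trans (cong (B (h j)) (trans (lookup-++ˡ (e VF.++ f) h _) (lookup-++ʳ e f i))) (B-hf i j)))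
          (λ i → trans (cong (B (h j)) (lookup-++ʳ (e VF.++ f) h i)) (B-hh j i))

      lincomb-coordinates-split : ∀ a b d → lincomb ((a VF.++ b) VF.++ d) bs ≗ (lincomb a e ⊕ lincomb b f) ⊕ lincomb d h
      lincomb-coordinates-split a b d j = trans (lincomb-++ _ (e VF.++ f) h j) (cong₂ _xor_
        (trans (lincomb-cong (e VF.++ f) (lookup-++ˡ (a VF.++ b) d) j)
               (trans (lincomb-++ (a VF.++ b) e f j)
                      (cong₂ _xor_ (lincomb-cong e (lookup-++ˡ a b) j) (lincomb-cong f (lookup-++ʳ a b) j))))
        (lincomb-cong h (lookup-++ʳ (a VF.++ b) d) j))

      B-e-lincomb-f : ∀ b i → B (e i) (lincomb b f) ≡ b i
      B-e-lincomb-f b i = begin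
        B (e i) (lincomb b f)                ≡⟨ B-sym (e i) _ ⟩
        B (lincomb b f) (e i)                ≡⟨ B-lincombˡ b f (e i) ⟩
        sum𝔽₂ (λ j → b j ∧ B (f j) (e i))    ≡⟨ sum𝔽₂-δ _ i (λ j j≢i → trans (cong (b j ∧_) (B-fe-≢ j i j≢i)) (∧-zeroʳ _)) ⟩
        b i ∧ B (f i) (e i)                  ≡⟨ cong (b i ∧_) (B-fe-≡ i i refl) ⟩
        b i ∧ true                           ≡⟨ ∧-identityʳ (b i) ⟩
        b i                                  ∎
        where open ≡-Reasoning

      module _ (Q-radical : ∀ x → (∀ y → B x y ≡ false) → Q x ≡ false) where

        Q-coordinates : ∀ a b d → Q (lincomb ((a VF.++ b) VF.++ d) bs) ≡ hyperbolicQuadratic (Q ∘ e) (Q ∘ f) a b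
        Q-coordinates a b d = begin
          Q (lincomb ((a VF.++ b) VF.++ d) bs)
            ≡⟨ Q-cong (lincomb-coordinates-split a b d) ⟩
          Q ((Ea ⊕ Fb) ⊕ Hd)
            ≡⟨ Q-⊕ (Ea ⊕ Fb) Hd ⟩
          (Q (Ea ⊕ Fb) xor Q Hd) xor B (Ea ⊕ Fb) Hd
            ≡⟨ cong₂ _xor_ (cong (Q (Ea ⊕ Fb) xor_) Q-Hd) (trans (B-sym (Ea ⊕ Fb) Hd) B-Hd) ⟩
          (Q (Ea ⊕ Fb) xor false) xor false
            ≡⟨ trans (xor-identityʳ _) (xor-identityʳ _) ⟩
          Q (Ea ⊕ Fb)
            ≡⟨ Q-⊕ Ea Fb ⟩
          (Q Ea xor Q Fb) xor B Ea Fb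
            ≡⟨ cong₂ _xor_ (cong₂ _xor_ (Q-lincomb a e B-ee) (Q-lincomb b f B-ff))
                           (trans (B-lincombˡ a e Fb) (sum𝔽₂-cong (λ i → cong (a i ∧_) (B-e-lincomb-f b i)))) ⟩
          (sum𝔽₂ (λ i → a i ∧ Q (e i)) xor sum𝔽₂ (λ i → b i ∧ Q (f i))) xor sum𝔽₂ (λ i → a i ∧ b i)
            ≡⟨ cong (_xor sum𝔽₂ (λ i → a i ∧ b i)) (sum𝔽₂-⊕ (λ i → a i ∧ Q (e i)) (λ i → b i ∧ Q (f i))) ⟨
          sum𝔽₂ (λ i → (a i ∧ Q (e i)) xor (b i ∧ Q (f i))) xor sum𝔽₂ (λ i → a i ∧ b i)
            ≡⟨ sum𝔽₂-⊕ (λ i → (a i ∧ Q (e i)) xor (b i ∧ Q (f i))) (λ i → a i ∧ b i) ⟨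
          hyperbolicQuadratic (Q ∘ e) (Q ∘ f) a b ∎
          where
          open ≡-Reasoning
          Ea = lincomb a e
          Fb = lincomb b f
          Hd = lincomb d h
          Q-Hd : Q Hd ≡ false
          Q-Hd = trans (Q-lincomb d h B-hh) (sum𝔽₂-zero _ (λ j → trans (cong (d j ∧_) (Q-radical (h j) (h-radical j))) (∧-zeroʳ _)))
          B-Hd : B Hd (Ea ⊕ Fb) ≡ false
          B-Hd = trans (B-lincombˡ d h (Ea ⊕ Fb)) (sum𝔽₂-zero _ (λ j → trans (cong (d j ∧_) (h-radical j (Ea ⊕ Fb))) (∧-zeroʳ _)))

        gauss-symplectic : gauss Q ≡ + (2 ℕ.^ l) * (+ (2 ℕ.^ k) * sg (sum𝔽₂ (λ i → Q (e i) ∧ Q (f i))))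
        gauss-symplectic = begin
          sumBits (sg ∘ Q)
            ≡⟨ sumBits-bijection (lincomb-cong bs) coordinates-cong coordinates-lincomb lincomb-coordinates
                                 (sg ∘ Q) (cong sg ∘ Q-cong) ⟩
          sumBits F
            ≡⟨ sumBits-++ (k ℕ.+ k) F F-cong ⟩
          sumBits {k ℕ.+ k} (λ u → sumBits {l} (λ d → F (u VF.++ d)))
            ≡⟨ sumBits-++ k _ (λ u≗u′ → sumBits-cong {l} (λ d → F-cong (++-cong _ _ u≗u′ (λ _ → refl)))) ⟩
          sumBits {k} (λ a → sumBits {k} (λ b → sumBits {l} (λ d → F ((a VF.++ b) VF.++ d))))
            ≡⟨ sumBits-cong {k} (λ a → sumBits-cong {k} (λ b → trans (sumBits-cong {l} (λ d → cong sg (Q-coordinates a b d)))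
                                                                     (sumBits-const l _))) ⟩
          sumBits {k} (λ a → sumBits {k} (λ b → + (2 ℕ.^ l) * sg (hyperbolicQuadratic (Q ∘ e) (Q ∘ f) a b)))
            ≡⟨ sumBits-cong {k} (λ a → sumBits-*ˡ {k} (+ (2 ℕ.^ l)) _) ⟩
          sumBits {k} (λ a → + (2 ℕ.^ l) * sumBits {k} (λ b → sg (hyperbolicQuadratic (Q ∘ e) (Q ∘ f) a b)))
            ≡⟨ sumBits-*ˡ {k} (+ (2 ℕ.^ l)) _ ⟩
          + (2 ℕ.^ l) * sumBits {k} (λ a → sumBits {k} (λ b → sg (hyperbolicQuadratic (Q ∘ e) (Q ∘ f) a b)))
            ≡⟨ cong (+ (2 ℕ.^ l) *_) (gauss-hyperbolic (Q ∘ e) (Q ∘ f)) ⟩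
          + (2 ℕ.^ l) * (+ (2 ℕ.^ k) * sg (sum𝔽₂ (λ i → Q (e i) ∧ Q (f i)))) ∎
          where
          open ≡-Reasoning
          F : Bits ((k ℕ.+ k) ℕ.+ l) → ℤ
          F c = sg (Q (lincomb c bs))
          F-cong : Congruent _≗_ _≡_ F
          F-cong c≗c′ = cong sg (Q-cong (lincomb-cong bs c≗c′))

  form : ∀ {n} → Matrix ℕ n → (Fin n → ℤ) → (Fin n → ℤ) → ℤ
  form B v w = sumℤ (λ i → sumℤ (λ j → v i * + B i j * w j))

  form-cong : ∀ {n} (B : Matrix ℕ n) {v v′ w w′ : Fin n → ℤ} → v ≗ v′ → w ≗ w′ → form B v w ≡ form B v′ w′
  form-cong B v≗v′ w≗w′ = sumℤ-cong (λ i → sumℤ-cong (λ j → cong₂ (λ a b → a * + B i j * b) (v≗v′ i) (w≗w′ j)))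

  0ᶻ : ∀ {n} → Fin n → ℤ
  0ᶻ _ = + 0

  form-zeroˡ : ∀ {n} (B : Matrix ℕ n) w → form B 0ᶻ w ≡ + 0
  form-zeroˡ B w = sumℤ-zero _ (λ i → sumℤ-zero _ (λ j → trans (cong (_* w j) (ℤ.*-zeroˡ (+ B i j))) (ℤ.*-zeroˡ (w j))))

  form-zeroʳ : ∀ {n} (B : Matrix ℕ n) v → form B v 0ᶻ ≡ + 0
  form-zeroʳ B v = sumℤ-zero _ (λ i → sumℤ-zero _ (λ j → ℤ.*-zeroʳ (v i * + B i j)))

  ⟨⟩≡form-mod4 : ∀ {n} (A : Matrix ℤ n) (B : Matrix ℕ n) → (∀ i j → (A mod4) i j ≡ B i j) →
                 ∀ v w → Lattice.⟨_,_⟩ A v w ≡ form B v w mod 4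
  ⟨⟩≡form-mod4 A B A≡B v w = sumℤ≗≡mod (λ i → sumℤ≗≡mod (λ j →
    ≡mod-* (≡mod-* (≡mod-refl (v i)) (subst (A i j ≡_mod 4) (cong +_ (A≡B i j)) (≡mod-%ℕ (A i j)))) (≡mod-refl (w j))))

  module _ (b : Block) (L : List Block) where
    private
      m = bsize b
      n = size L
      D = blockDiag (b ∷ L)

    blockDiag-↑ˡ↑ˡ : ∀ i j → D (i ↑ˡ n) (j ↑ˡ n) ≡ bmat b i j
    blockDiag-↑ˡ↑ˡ i j rewrite splitAt-↑ˡ m i n | splitAt-↑ˡ m j n = refl

    blockDiag-↑ˡ↑ʳ : ∀ i j → D (i ↑ˡ n) (m ↑ʳ j) ≡ 0
    blockDiag-↑ˡ↑ʳ i j rewrite splitAt-↑ˡ m i n | splitAt-↑ʳ m n j = refl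

    blockDiag-↑ʳ↑ˡ : ∀ i j → D (m ↑ʳ i) (j ↑ˡ n) ≡ 0
    blockDiag-↑ʳ↑ˡ i j rewrite splitAt-↑ʳ m n i | splitAt-↑ˡ m j n = refl

    blockDiag-↑ʳ↑ʳ : ∀ i j → D (m ↑ʳ i) (m ↑ʳ j) ≡ blockDiag L i j
    blockDiag-↑ʳ↑ʳ i j rewrite splitAt-↑ʳ m n i | splitAt-↑ʳ m n j = refl

    form-blockDiag : ∀ v w → form D v w ≡ form (bmat b) (VF.take m v) (VF.take m w)
                                        + form (blockDiag L) (VF.drop m v) (VF.drop m w)
    form-blockDiag v w = trans (sumℤ-++ m _) (cong₂ _+_ (sumℤ-cong top) (sumℤ-cong bottom))
      where
      term : ∀ d i j → d ≡ 0 → v i * + d * w j ≡ + 0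
      term d i j refl = trans (cong (_* w j) (ℤ.*-zeroʳ (v i))) (ℤ.*-zeroˡ (w j))
      top : ∀ i → sumℤ (λ j → v (i ↑ˡ n) * + D (i ↑ˡ n) j * w j)
                ≡ sumℤ (λ j → v (i ↑ˡ n) * + bmat b i j * w (j ↑ˡ n))
      top i = trans (sumℤ-++ m _) (trans
        (cong₂ _+_ (sumℤ-cong (λ j → cong (λ d → v (i ↑ˡ n) * + d * w (j ↑ˡ n)) (blockDiag-↑ˡ↑ˡ i j)))
                   (sumℤ-zero _ (λ j → term _ (i ↑ˡ n) (m ↑ʳ j) (blockDiag-↑ˡ↑ʳ i j))))
        (ℤ.+-identityʳ _))
      bottom : ∀ i → sumℤ (λ j → v (m ↑ʳ i) * + D (m ↑ʳ i) j * w j)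
                   ≡ sumℤ (λ j → v (m ↑ʳ i) * + blockDiag L i j * w (m ↑ʳ j))
      bottom i = trans (sumℤ-++ m _) (trans
        (cong₂ _+_ (sumℤ-zero _ (λ j → term _ (m ↑ʳ i) (j ↑ˡ n) (blockDiag-↑ʳ↑ˡ i j)))
                   (sumℤ-cong (λ j → cong (λ d → v (m ↑ʳ i) * + d * w (m ↑ʳ j)) (blockDiag-↑ʳ↑ʳ i j))))
        (ℤ.+-identityˡ _))

  module _ (b : Block) (L : List Block) (v : Fin (bsize b ℕ.+ size L) → ℤ) where
    private
      m = bsize b

    form-blockDiag-first : ∀ w₁ → form (blockDiag (b ∷ L)) v (w₁ VF.++ 0ᶻ) ≡ form (bmat b) (VF.take m v) w₁
    form-blockDiag-first w₁ = trans (form-blockDiag b L v (w₁ VF.++ 0ᶻ)) (trans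
      (cong₂ _+_ (form-cong (bmat b) {v = VF.take m v} (λ _ → refl) (lookup-++ˡ w₁ 0ᶻ))
                 (trans (form-cong (blockDiag L) {v = VF.drop m v} (λ _ → refl) (lookup-++ʳ w₁ 0ᶻ)) (form-zeroʳ (blockDiag L) (VF.drop m v))))
      (ℤ.+-identityʳ _))

    form-blockDiag-rest : ∀ w₂ → form (blockDiag (b ∷ L)) v (0ᶻ VF.++ w₂) ≡ form (blockDiag L) (VF.drop m v) w₂
    form-blockDiag-rest w₂ = trans (form-blockDiag b L v (0ᶻ VF.++ w₂)) (trans
      (cong₂ _+_ (trans (form-cong (bmat b) {v = VF.take m v} (λ _ → refl) (lookup-++ˡ 0ᶻ w₂)) (form-zeroʳ (bmat b) (VF.take m v)))
                 (form-cong (blockDiag L) {v = VF.drop m v} (λ _ → refl) (lookup-++ʳ {m = m} 0ᶻ w₂)))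
      (ℤ.+-identityˡ _))

  -- Lattice.lift, without the matrix parameter.
  lift : ∀ {n} → Bits n → Fin n → ℤ
  lift x = ι ∘ x

  diagonal cross : (v w : Fin 2 → ℤ) → ℤ
  diagonal v w = v 0F * w 0F + v 1F * w 1F
  cross    v w = v 0F * w 1F + v 1F * w 0F

  form-2x2 : ∀ d o v w → form (2x2 d o) v w ≡ + d * diagonal v w + + o * cross v w
  form-2x2 d o v w = expand (+ d) (+ o) (v 0F) (v 1F) (w 0F) (w 1F)
    where
    -- The left-hand side is how form (2x2 d o) v w unfolds.
    expand : ∀ d o v₀ v₁ w₀ w₁ → (v₀ * d * w₀ + (v₀ * o * w₁ + + 0)) + ((v₁ * o * w₀ + (v₁ * d * w₁ + + 0)) + + 0)
                                ≡ d * (v₀ * w₀ + v₁ * w₁) + o * (v₀ * w₁ + v₁ * w₀)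
    expand = solve-∀

  hyperbolicPairing : Bits 2 → Bits 2 → Bool
  hyperbolicPairing x y = (x 0F ∧ y 1F) xor (x 1F ∧ y 0F)

  -- (x, y) mod 2 and (x, x)/2 mod 2 for the block matrix bmat b, evaluated on {0, 1}-vectors.
  blockΩ : (b : Block) → Bits (bsize b) → Bits (bsize b) → Bool
  blockΩ B21  = hyperbolicPairing
  blockΩ B01  = hyperbolicPairing
  blockΩ B02  _ _ = false
  blockΩ One2 _ _ = false
  blockΩ One0 _ _ = false

  blockq : (b : Block) → Bits (bsize b) → Bool
  blockq B21  x = (x 0F xor x 1F) xor (x 0F ∧ x 1F)
  blockq B01  x = x 0F ∧ x 1F
  blockq B02  _ = false
  blockq One2 x = x 0F
  blockq One0 _ = false

  Ω[_] : (L : List Block) → Bits (size L) → Bits (size L) → Bool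
  Ω[ []    ] x y = false
  Ω[ b ∷ L ] x y =
    blockΩ b (VF.take (bsize b) x) (VF.take (bsize b) y) xor Ω[ L ] (VF.drop (bsize b) x) (VF.drop (bsize b) y)

  q[_] : (L : List Block) → Bits (size L) → Bool
  q[ []    ] x = false
  q[ b ∷ L ] x = blockq b (VF.take (bsize b) x) xor q[ L ] (VF.drop (bsize b) x)

  cross≡hyperbolicPairing : ∀ x y → cross (lift x) (lift y) ≡ ι (hyperbolicPairing x y) mod 2
  cross≡hyperbolicPairing x y = ≡mod-sym (≡mod-trans (ι-xor (x 0F ∧ y 1F) (x 1F ∧ y 0F))
    (≡mod-reflexive (cong₂ _+_ (ι-∧ (x 0F) (y 1F)) (ι-∧ (x 1F) (y 0F)))))

  form-blockΩ : ∀ b x y → form (bmat b) (lift x) (lift y) ≡ ι (blockΩ b x y) mod 2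
  form-blockΩ B21 x y = ≡mod-trans (≡mod-from-≡ (diagonal v w) (trans (form-2x2 2 1 v w) (regroup (diagonal v w) (cross v w))))
                                   (cross≡hyperbolicPairing x y)
    where
    v = lift x
    w = lift y
    regroup : ∀ D C → + 2 * D + + 1 * C ≡ C + D * + 2
    regroup = solve-∀
  form-blockΩ B01 x y = ≡mod-trans (≡mod-reflexive (trans (form-2x2 0 1 v w) (regroup (diagonal v w) (cross v w))))
                                   (cross≡hyperbolicPairing x y)
    where
    v = lift x
    w = lift y
    regroup : ∀ D C → + 0 * D + + 1 * C ≡ C
    regroup = solve-∀
  form-blockΩ B02 x y = ≡mod-from-≡ (cross v w) (trans (form-2x2 0 2 v w) (regroup (diagonal v w) (cross v w)))
    where
    v = lift x
    w = lift y
    regroup : ∀ D C → + 0 * D + + 2 * C ≡ + 0 + C * + 2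
    regroup = solve-∀
  form-blockΩ One2 x y = ≡mod-from-≡ (ι (x 0F) * ι (y 0F)) (regroup (ι (x 0F)) (ι (y 0F)))
    where
    regroup : ∀ a c → (a * + 2 * c + + 0) + + 0 ≡ + 0 + a * c * + 2
    regroup = solve-∀
  form-blockΩ One0 x y = ≡mod-reflexive (regroup (ι (x 0F)) (ι (y 0F)))
    where
    regroup : ∀ a c → (a * + 0 * c + + 0) + + 0 ≡ + 0
    regroup = solve-∀

  form-blockq : ∀ b x → form (bmat b) (lift x) (lift x) ≡ ι (blockq b x) * + 2 mod 4
  form-blockq B21 x = ≡mod-trans (≡mod-reflexive (form-2x2 2 1 (lift x) (lift x))) (check (x 0F) (x 1F))
    where
    check : ∀ a b → + 2 * (ι a * ι a + ι b * ι b) + + 1 * (ι a * ι b + ι b * ι a) ≡ ι ((a xor b) xor (a ∧ b)) * + 2 mod 4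
    check false false = %ℕ≡0⇒≡mod refl
    check false true  = %ℕ≡0⇒≡mod refl
    check true  false = %ℕ≡0⇒≡mod refl
    check true  true  = %ℕ≡0⇒≡mod refl
  form-blockq B01 x = ≡mod-trans (≡mod-reflexive (form-2x2 0 1 (lift x) (lift x))) (check (x 0F) (x 1F))
    where
    check : ∀ a b → + 0 * (ι a * ι a + ι b * ι b) + + 1 * (ι a * ι b + ι b * ι a) ≡ ι (a ∧ b) * + 2 mod 4
    check false false = %ℕ≡0⇒≡mod refl
    check false true  = %ℕ≡0⇒≡mod refl
    check true  false = %ℕ≡0⇒≡mod refl
    check true  true  = %ℕ≡0⇒≡mod refl
  form-blockq B02 x = ≡mod-trans (≡mod-reflexive (form-2x2 0 2 (lift x) (lift x))) (check (x 0F) (x 1F))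
    where
    check : ∀ a b → + 0 * (ι a * ι a + ι b * ι b) + + 2 * (ι a * ι b + ι b * ι a) ≡ + 0 mod 4
    check false false = %ℕ≡0⇒≡mod refl
    check false true  = %ℕ≡0⇒≡mod refl
    check true  false = %ℕ≡0⇒≡mod refl
    check true  true  = %ℕ≡0⇒≡mod refl
  form-blockq One2 x = check (x 0F)
    where
    check : ∀ a → (ι a * + 2 * ι a + + 0) + + 0 ≡ ι a * + 2 mod 4
    check false = %ℕ≡0⇒≡mod refl
    check true  = %ℕ≡0⇒≡mod refl
  form-blockq One0 x = check (x 0F)
    where
    check : ∀ a → (ι a * + 0 * ι a + + 0) + + 0 ≡ + 0 mod 4
    check false = %ℕ≡0⇒≡mod refl
    check true  = %ℕ≡0⇒≡mod refl

  form≡Ω[] : ∀ L (x y : Bits (size L)) → form (blockDiag L) (lift x) (lift y) ≡ ι (Ω[ L ] x y) mod 2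
  form≡Ω[] []      x y = ≡mod-refl _
  form≡Ω[] (b ∷ L) x y = ≡mod-trans (≡mod-reflexive (form-blockDiag b L (lift x) (lift y)))
    (≡mod-trans (≡mod-+ (form-blockΩ b x₁ y₁) (form≡Ω[] L x₂ y₂)) (≡mod-sym (ι-xor (blockΩ b x₁ y₁) (Ω[ L ] x₂ y₂))))
    where
    x₁ = VF.take (bsize b) x
    y₁ = VF.take (bsize b) y
    x₂ = VF.drop (bsize b) x
    y₂ = VF.drop (bsize b) y

  form≡q[] : ∀ L (x : Bits (size L)) → form (blockDiag L) (lift x) (lift x) ≡ ι (q[ L ] x) * + 2 mod 4
  form≡q[] []      x = ≡mod-refl _
  form≡q[] (b ∷ L) x = ≡mod-trans (≡mod-reflexive (form-blockDiag b L (lift x) (lift x)))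
    (≡mod-trans (≡mod-+ (form-blockq b x₁) (form≡q[] L x₂))
                (≡mod-trans (≡mod-reflexive (sym (ℤ.*-distribʳ-+ (+ 2) (ι (blockq b x₁)) (ι (q[ L ] x₂)))))
                            (≡mod2⇒*2≡mod4 (≡mod-sym (ι-xor (blockq b x₁) (q[ L ] x₂))))))
    where
    x₁ = VF.take (bsize b) x
    x₂ = VF.drop (bsize b) x

  blockq-cong : ∀ b {x y : Bits (bsize b)} → x ≗ y → blockq b x ≡ blockq b y
  blockq-cong B21  x≗y = cong₂ (λ a c → (a xor c) xor (a ∧ c)) (x≗y 0F) (x≗y 1F)
  blockq-cong B01  x≗y = cong₂ _∧_ (x≗y 0F) (x≗y 1F)
  blockq-cong B02  x≗y = refl
  blockq-cong One2 x≗y = x≗y 0F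
  blockq-cong One0 x≗y = refl

  hyperbolicPairing-cong : ∀ {x x′ y y′ : Bits 2} → x ≗ x′ → y ≗ y′ → hyperbolicPairing x y ≡ hyperbolicPairing x′ y′
  hyperbolicPairing-cong x≗x′ y≗y′ = cong₂ _xor_ (cong₂ _∧_ (x≗x′ 0F) (y≗y′ 1F)) (cong₂ _∧_ (x≗x′ 1F) (y≗y′ 0F))

  blockΩ-cong : ∀ b {x x′ y y′ : Bits (bsize b)} → x ≗ x′ → y ≗ y′ → blockΩ b x y ≡ blockΩ b x′ y′
  blockΩ-cong B21  = hyperbolicPairing-cong
  blockΩ-cong B01  = hyperbolicPairing-cong
  blockΩ-cong B02  _ _ = refl
  blockΩ-cong One2 _ _ = refl
  blockΩ-cong One0 _ _ = refl

  hyperbolicPairing-sym : ∀ x y → hyperbolicPairing x y ≡ hyperbolicPairing y x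
  hyperbolicPairing-sym x y = swap (x 0F) (x 1F) (y 0F) (y 1F)
    where
    swap : ∀ a₀ a₁ c₀ c₁ → (a₀ ∧ c₁) xor (a₁ ∧ c₀) ≡ (c₀ ∧ a₁) xor (c₁ ∧ a₀)
    swap = RingSolver.solve-∀ 𝔽₂

  hyperbolicPairing-⊕ˡ : ∀ x y z → hyperbolicPairing (x ⊕ y) z ≡ hyperbolicPairing x z xor hyperbolicPairing y z
  hyperbolicPairing-⊕ˡ x y z = distribute (x 0F) (x 1F) (y 0F) (y 1F) (z 0F) (z 1F)
    where
    distribute : ∀ a₀ a₁ b₀ b₁ c₀ c₁ → ((a₀ xor b₀) ∧ c₁) xor ((a₁ xor b₁) ∧ c₀)
                                        ≡ ((a₀ ∧ c₁) xor (a₁ ∧ c₀)) xor ((b₀ ∧ c₁) xor (b₁ ∧ c₀))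
    distribute = RingSolver.solve-∀ 𝔽₂

  blockΩ-sym : ∀ b x y → blockΩ b x y ≡ blockΩ b y x
  blockΩ-sym B21  = hyperbolicPairing-sym
  blockΩ-sym B01  = hyperbolicPairing-sym
  blockΩ-sym B02  _ _ = refl
  blockΩ-sym One2 _ _ = refl
  blockΩ-sym One0 _ _ = refl

  blockΩ-⊕ˡ : ∀ b x y z → blockΩ b (x ⊕ y) z ≡ blockΩ b x z xor blockΩ b y z
  blockΩ-⊕ˡ B21  = hyperbolicPairing-⊕ˡ
  blockΩ-⊕ˡ B01  = hyperbolicPairing-⊕ˡ
  blockΩ-⊕ˡ B02  _ _ _ = refl
  blockΩ-⊕ˡ One2 _ _ _ = refl
  blockΩ-⊕ˡ One0 _ _ _ = refl

  blockq-⊕ : ∀ b x y → blockq b (x ⊕ y) ≡ (blockq b x xor blockq b y) xor blockΩ b x y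
  blockq-⊕ B21  x y = expand (x 0F) (x 1F) (y 0F) (y 1F)
    where
    expand : ∀ a₀ a₁ b₀ b₁ → ((a₀ xor b₀) xor (a₁ xor b₁)) xor ((a₀ xor b₀) ∧ (a₁ xor b₁))
                             ≡ ((((a₀ xor a₁) xor (a₀ ∧ a₁)) xor ((b₀ xor b₁) xor (b₀ ∧ b₁))) xor ((a₀ ∧ b₁) xor (a₁ ∧ b₀)))
    expand = RingSolver.solve-∀ 𝔽₂
  blockq-⊕ B01  x y = expand (x 0F) (x 1F) (y 0F) (y 1F)
    where
    expand : ∀ a₀ a₁ b₀ b₁ → (a₀ xor b₀) ∧ (a₁ xor b₁) ≡ ((a₀ ∧ a₁) xor (b₀ ∧ b₁)) xor ((a₀ ∧ b₁) xor (a₁ ∧ b₀))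
    expand = RingSolver.solve-∀ 𝔽₂
  blockq-⊕ B02  x y = refl
  blockq-⊕ One2 x y = sym (xor-identityʳ _)
  blockq-⊕ One0 x y = refl

  q[]-isQuadraticForm : ∀ L → IsQuadraticForm q[ L ] Ω[ L ]
  q[]-isQuadraticForm []      = record
    { Q-cong = λ _ → refl ; B-cong = λ _ _ → refl ; B-sym = λ _ _ → refl ; B-⊕ˡ = λ _ _ _ → refl ; Q-⊕ = λ _ _ → refl }
  q[]-isQuadraticForm (b ∷ L) = record
    { Q-cong = λ x≗y → cong₂ _xor_ (blockq-cong b (x≗y ∘ (_↑ˡ _))) (Q-cong (x≗y ∘ (bsize b ↑ʳ_)))
    ; B-cong = λ x≗x′ y≗y′ → cong₂ _xor_ (blockΩ-cong b (x≗x′ ∘ (_↑ˡ _)) (y≗y′ ∘ (_↑ˡ _)))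
                                          (B-cong (x≗x′ ∘ (bsize b ↑ʳ_)) (y≗y′ ∘ (bsize b ↑ʳ_)))
    ; B-sym  = λ x y → cong₂ _xor_ (blockΩ-sym b (top x) (top y)) (B-sym (rest x) (rest y))
    ; B-⊕ˡ   = λ x y z → trans (cong₂ _xor_ (blockΩ-⊕ˡ b (top x) (top y) (top z)) (B-⊕ˡ (rest x) (rest y) (rest z)))
                               (interchange (blockΩ b (top x) (top z)) (blockΩ b (top y) (top z)) _ _)
    ; Q-⊕    = λ x y → trans (cong₂ _xor_ (blockq-⊕ b (top x) (top y)) (Q-⊕ (rest x) (rest y)))
                             (regroup (blockq b (top x)) (blockq b (top y)) (blockΩ b (top x) (top y))
                                      (q[ L ] (rest x)) (q[ L ] (rest y)) (Ω[ L ] (rest x) (rest y)))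
    }
    where
    open IsQuadraticForm (q[]-isQuadraticForm L)
    top : Bits (bsize b ℕ.+ size L) → Bits (bsize b)
    top = VF.take (bsize b)
    rest : Bits (bsize b ℕ.+ size L) → Bits (size L)
    rest = VF.drop (bsize b)
    interchange : ∀ a b c d → (a xor b) xor (c xor d) ≡ (a xor c) xor (b xor d)
    interchange = RingSolver.solve-∀ 𝔽₂
    regroup : ∀ a b c a′ b′ c′ → ((a xor b) xor c) xor ((a′ xor b′) xor c′) ≡ ((a xor a′) xor (b xor b′)) xor (c xor c′)
    regroup = RingSolver.solve-∀ 𝔽₂

  module _ {n} (A : Matrix ℤ n) where
    open Lattice A hiding (lift)

    ⟨⟩-cong-mod : ∀ {k} {v v′ w w′ : V} → (∀ i → v i ≡ v′ i mod k) → (∀ j → w j ≡ w′ j mod k) → ⟨ v , w ⟩ ≡ ⟨ v′ , w′ ⟩ mod k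
    ⟨⟩-cong-mod v≡v′ w≡w′ = sumℤ≗≡mod (λ i → sumℤ≗≡mod (λ j → ≡mod-* (≡mod-* (v≡v′ i) (≡mod-refl (A i j))) (w≡w′ j)))

    ≡lift∘red : ∀ v i → v i ≡ lift (red v) i mod 2
    ≡lift∘red v i = ≡mod-trans (≡mod-%ℕ (v i)) (≡mod-reflexive (ι-residue (n%ℕd<d (v i) 2)))

    -- V̄₀ is the radical of Ω, since (v, w) mod 2 only depends on v and w mod 2.
    V̄₀⇒radical : ∀ {x} → V̄₀ x → ∀ y → Ω x y ≡ 0
    V̄₀⇒radical {x} (v , v∈V₀ , red-v≈x) y = %ℕ-unique (ℕ.s≤s ℕ.z≤n) (≡mod-trans
      (⟨⟩-cong-mod (λ i → ≡mod-sym (≡mod-trans (≡lift∘red v i) (≡mod-reflexive (cong ι (red-v≈x i))))) (≡mod-refl ∘ lift y))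
      (∣⇒≡0mod (v∈V₀ (lift y))))

    radical⇒V̄₀ : ∀ {x} → (∀ y → Ω x y ≡ 0) → V̄₀ x
    radical⇒V̄₀ {x} x⊥ = lift x , lift-x∈V₀ , red-ι ∘ x
      where
      lift-x∈V₀ : V₀ (lift x)
      lift-x∈V₀ w = ≡0mod⇒∣ (≡mod-trans (⟨⟩-cong-mod (≡mod-refl ∘ lift x) (≡lift∘red w))
                                        (≡mod-trans (≡mod-%ℕ _) (≡mod-reflexive (cong +_ (x⊥ (red w))))))

  blockwise : (∀ b → Bits (bsize b)) → (L : List Block) → Bits (size L)
  blockwise f []      = VF.[]
  blockwise f (b ∷ L) = f b VF.++ blockwise f L

  -- The coordinates of the normal form that span V̄₀, resp. V̄₀₀₀.
  blockMask₀ blockMask₀₀₀ : (b : Block) → Bits (bsize b)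
  blockMask₀ B21  = 0ᵇ
  blockMask₀ B01  = 0ᵇ
  blockMask₀ B02  = λ _ → true
  blockMask₀ One2 = λ _ → true
  blockMask₀ One0 = λ _ → true
  blockMask₀₀₀ One0 = λ _ → true
  blockMask₀₀₀ _    = 0ᵇ

  mask₀ mask₀₀₀ : (L : List Block) → Bits (size L)
  mask₀   = blockwise blockMask₀
  mask₀₀₀ = blockwise blockMask₀₀₀

  count-blockwise : ∀ f L → count (blockwise f L) ≡ sum (map (count ∘ f) L)
  count-blockwise f []      = refl
  count-blockwise f (b ∷ L) = trans (count-++ (f b) (blockwise f L)) (cong (count (f b) ℕ.+_) (count-blockwise f L))

  hyperbolicPairing-nondegenerate : ∀ x → (∀ y → hyperbolicPairing x y ≡ false) → x ≗ 0ᵇ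
  hyperbolicPairing-nondegenerate x x⊥ 0F = pick (x 0F) (x 1F) (x⊥ (false VF.∷ true VF.∷ VF.[]))
    where
    pick : ∀ a b → (a ∧ true) xor (b ∧ false) ≡ false → a ≡ false
    pick false _ _ = refl
    pick true false ()
    pick true true ()
  hyperbolicPairing-nondegenerate x x⊥ 1F = pick (x 0F) (x 1F) (x⊥ (true VF.∷ false VF.∷ VF.[]))
    where
    pick : ∀ a b → (a ∧ false) xor (b ∧ true) ≡ false → b ≡ false
    pick _ false _ = refl
    pick false true ()
    pick true true ()

  blockΩ-radical : ∀ b x → (∀ y → blockΩ b x y ≡ false) → SupportedOn (blockMask₀ b) x
  blockΩ-radical B21  x x⊥ j _ = hyperbolicPairing-nondegenerate x x⊥ j
  blockΩ-radical B01  x x⊥ j _ = hyperbolicPairing-nondegenerate x x⊥ j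
  blockΩ-radical B02  x x⊥ j ()
  blockΩ-radical One2 x x⊥ j ()
  blockΩ-radical One0 x x⊥ j ()

  blockΩ-supported : ∀ b x → SupportedOn (blockMask₀ b) x → ∀ y → blockΩ b x y ≡ false
  blockΩ-supported B21  x x∈M y = hyperbolicPairing-cong {y = y} (λ j → x∈M j refl) (λ _ → refl)
  blockΩ-supported B01  x x∈M y = hyperbolicPairing-cong {y = y} (λ j → x∈M j refl) (λ _ → refl)
  blockΩ-supported B02  x x∈M y = refl
  blockΩ-supported One2 x x∈M y = refl
  blockΩ-supported One0 x x∈M y = refl

  blockΩ-0ᵇʳ : ∀ b x → blockΩ b x 0ᵇ ≡ false
  blockΩ-0ᵇʳ B21  x = cong₂ _xor_ (∧-zeroʳ (x 0F)) (∧-zeroʳ (x 1F))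
  blockΩ-0ᵇʳ B01  x = cong₂ _xor_ (∧-zeroʳ (x 0F)) (∧-zeroʳ (x 1F))
  blockΩ-0ᵇʳ B02  x = refl
  blockΩ-0ᵇʳ One2 x = refl
  blockΩ-0ᵇʳ One0 x = refl

  radical⇒mask₀ : ∀ L x → (∀ y → Ω[ L ] x y ≡ false) → SupportedOn (mask₀ L) x
  radical⇒mask₀ []      x x⊥ ()
  radical⇒mask₀ (b ∷ L) x x⊥ = SupportedOn-++ (blockΩ-radical b x₁ x₁⊥) (radical⇒mask₀ L x₂ x₂⊥)
    where
    open IsQuadraticForm (q[]-isQuadraticForm L) using (B-cong)
    open QuadraticForm (q[]-isQuadraticForm L) using (B-0ᵇʳ)
    open ≡-Reasoning
    x₁ = VF.take (bsize b) x
    x₂ = VF.drop (bsize b) x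
    x₁⊥ : ∀ y₁ → blockΩ b x₁ y₁ ≡ false
    x₁⊥ y₁ = begin
      blockΩ b x₁ y₁                                    ≡⟨ xor-identityʳ _ ⟨
      blockΩ b x₁ y₁ xor false                          ≡⟨ cong₂ _xor_ (blockΩ-cong b (λ _ → refl) (sym ∘ lookup-++ˡ y₁ 0ᵇ))
                                                                       (sym (trans (B-cong (λ _ → refl) (lookup-++ʳ y₁ 0ᵇ)) (B-0ᵇʳ x₂))) ⟩
      Ω[ b ∷ L ] x (y₁ VF.++ 0ᵇ)                         ≡⟨ x⊥ (y₁ VF.++ 0ᵇ) ⟩
      false                                             ∎
    x₂⊥ : ∀ y₂ → Ω[ L ] x₂ y₂ ≡ false
    x₂⊥ y₂ = begin
      Ω[ L ] x₂ y₂                                      ≡⟨ cong₂ _xor_ (sym (trans (blockΩ-cong b (λ _ → refl) (lookup-++ˡ 0ᵇ y₂)) (blockΩ-0ᵇʳ b x₁)))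
                                                                       (B-cong (λ _ → refl) (sym ∘ lookup-++ʳ {m = bsize b} 0ᵇ y₂)) ⟩
      Ω[ b ∷ L ] x (0ᵇ VF.++ y₂)                         ≡⟨ x⊥ (0ᵇ VF.++ y₂) ⟩
      false                                             ∎

  mask₀⇒radical : ∀ L x → SupportedOn (mask₀ L) x → ∀ y → Ω[ L ] x y ≡ false
  mask₀⇒radical []      x x∈M y = refl
  mask₀⇒radical (b ∷ L) x x∈M y =
    cong₂ _xor_ (blockΩ-supported b _ (SupportedOn-take x∈M) _) (mask₀⇒radical L _ (SupportedOn-drop x∈M) _)

  -- On the coordinates of V̄₀ outside V̄₀₀₀ the normal form is 2 mod 4, so pairing with a unit vector gives 2 vⱼ.
  block-V₀₀₀-even : ∀ b v → (∀ w → form (bmat b) v w ≡ + 0 mod 4) →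
                    ∀ j → blockMask₀ b j ≡ true → blockMask₀₀₀ b j ≡ false → v j ≡ + 0 mod 2
  block-V₀₀₀-even B21  v v⊥ j ()
  block-V₀₀₀-even B01  v v⊥ j ()
  block-V₀₀₀-even B02  v v⊥ 0F _ _ = *2≡mod4⇒≡mod2 (subst (_≡ + 0 mod 4) (trans (form-2x2 0 2 v e₁) (pair (v 0F) (v 1F))) (v⊥ e₁))
    where
    e₁ = + 0 VF.∷ + 1 VF.∷ VF.[]
    pair : ∀ v₀ v₁ → + 0 * (v₀ * + 0 + v₁ * + 1) + + 2 * (v₀ * + 1 + v₁ * + 0) ≡ v₀ * + 2
    pair = solve-∀
  block-V₀₀₀-even B02  v v⊥ 1F _ _ = *2≡mod4⇒≡mod2 (subst (_≡ + 0 mod 4) (trans (form-2x2 0 2 v e₀) (pair (v 0F) (v 1F))) (v⊥ e₀))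
    where
    e₀ = + 1 VF.∷ + 0 VF.∷ VF.[]
    pair : ∀ v₀ v₁ → + 0 * (v₀ * + 1 + v₁ * + 0) + + 2 * (v₀ * + 0 + v₁ * + 1) ≡ v₁ * + 2
    pair = solve-∀
  block-V₀₀₀-even One2 v v⊥ 0F _ _ = *2≡mod4⇒≡mod2 (subst (_≡ + 0 mod 4) (pair (v 0F)) (v⊥ (+ 1 VF.∷ VF.[])))
    where
    pair : ∀ v₀ → (v₀ * + 2 * + 1 + + 0) + + 0 ≡ v₀ * + 2
    pair = solve-∀
  block-V₀₀₀-even One0 v v⊥ j _ ()

  V₀₀₀-even : ∀ L v → (∀ w → form (blockDiag L) v w ≡ + 0 mod 4) →
              ∀ j → mask₀ L j ≡ true → mask₀₀₀ L j ≡ false → v j ≡ + 0 mod 2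
  V₀₀₀-even []      v v⊥ ()
  V₀₀₀-even (b ∷ L) v v⊥ = ↑-cases _
    (λ i M₀ M₀₀₀ → block-V₀₀₀-even b (VF.take (bsize b) v) (λ w₁ → subst (_≡ + 0 mod 4) (form-blockDiag-first b L v w₁) (v⊥ _)) i
                     (trans (sym (lookup-++ˡ (blockMask₀ b) (mask₀ L) i)) M₀) (trans (sym (lookup-++ˡ (blockMask₀₀₀ b) (mask₀₀₀ L) i)) M₀₀₀))
    (λ i M₀ M₀₀₀ → V₀₀₀-even L (VF.drop (bsize b) v) (λ w₂ → subst (_≡ + 0 mod 4) (form-blockDiag-rest b L v w₂) (v⊥ _)) i
                     (trans (sym (lookup-++ʳ (blockMask₀ b) (mask₀ L) i)) M₀) (trans (sym (lookup-++ʳ (blockMask₀₀₀ b) (mask₀₀₀ L) i)) M₀₀₀))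

  form-lift-0ᵇ : ∀ {n} (B : Matrix ℕ n) {x : Bits n} → x ≗ 0ᵇ → ∀ w → form B (lift x) w ≡ + 0
  form-lift-0ᵇ B x≗0 w = trans (form-cong B {w = w} (cong ι ∘ x≗0) (λ _ → refl)) (form-zeroˡ B w)

  block-mask₀₀₀-form≡0 : ∀ b x → SupportedOn (blockMask₀₀₀ b) x → ∀ w → form (bmat b) (lift x) w ≡ + 0
  block-mask₀₀₀-form≡0 One0 x x∈M w = vanish (lift x 0F) (w 0F)
    where
    vanish : ∀ a c → (a * + 0 * c + + 0) + + 0 ≡ + 0
    vanish = solve-∀
  block-mask₀₀₀-form≡0 B21  x x∈M = form-lift-0ᵇ (bmat B21)  (λ j → x∈M j refl)
  block-mask₀₀₀-form≡0 B01  x x∈M = form-lift-0ᵇ (bmat B01)  (λ j → x∈M j refl)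
  block-mask₀₀₀-form≡0 B02  x x∈M = form-lift-0ᵇ (bmat B02)  (λ j → x∈M j refl)
  block-mask₀₀₀-form≡0 One2 x x∈M = form-lift-0ᵇ (bmat One2) (λ j → x∈M j refl)

  mask₀₀₀-form≡0 : ∀ L x → SupportedOn (mask₀₀₀ L) x → ∀ w → form (blockDiag L) (lift x) w ≡ + 0
  mask₀₀₀-form≡0 []      x x∈M w = refl
  mask₀₀₀-form≡0 (b ∷ L) x x∈M w = trans (form-blockDiag b L (lift x) w)
    (cong₂ _+_ (block-mask₀₀₀-form≡0 b _ (SupportedOn-take x∈M) _) (mask₀₀₀-form≡0 L _ (SupportedOn-drop x∈M) _))

  module NormalForm (L : List Block) (A : Matrix ℤ (size L)) (A≡L : ∀ i j → (A mod4) i j ≡ blockDiag L i j) where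
    open Lattice A hiding (lift)

    Ω≡Ω[] : ∀ x y → Ω x y ≡ bit (Ω[ L ] x y)
    Ω≡Ω[] x y =
      %ℕ2≡bit (≡mod-trans (≡mod*⇒≡mod {2} {2} (⟨⟩≡form-mod4 A (blockDiag L) A≡L (lift x) (lift y))) (form≡Ω[] L x y))

    q≡q[] : ∀ x → q x ≡ bit (q[ L ] x)
    q≡q[] x = /ℕ2%ℕ2≡bit (≡mod-trans (⟨⟩≡form-mod4 A (blockDiag L) A≡L (lift x) (lift x)) (form≡q[] L x))

    V̄₀⇒mask₀ : ∀ {x} → V̄₀ x → SupportedOn (mask₀ L) x
    V̄₀⇒mask₀ {x} x∈V̄₀ = radical⇒mask₀ L x (λ y → bit≡0⇒false (trans (sym (Ω≡Ω[] x y)) (V̄₀⇒radical A x∈V̄₀ y)))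

    mask₀⇒V̄₀ : ∀ {x} → SupportedOn (mask₀ L) x → V̄₀ x
    mask₀⇒V̄₀ {x} x∈M = radical⇒V̄₀ A (λ y → trans (Ω≡Ω[] x y) (cong bit (mask₀⇒radical L x x∈M y)))

    V̄₀₀₀⇒mask₀₀₀ : ∀ {x} → V̄₀₀₀ x → SupportedOn (mask₀₀₀ L) x
    V̄₀₀₀⇒mask₀₀₀ {x} (v , (v∈V₀ , v∈V₀₀₀) , red-v≈x) j M₀₀₀ with mask₀ L j in M₀
    ... | false = V̄₀⇒mask₀ (v , v∈V₀ , red-v≈x) j M₀
    ... | true  = trans (sym (red-v≈x j)) (cong (ℕ._≡ᵇ 1) (%ℕ-unique (ℕ.s≤s ℕ.z≤n) (V₀₀₀-even L v v⊥ j M₀ M₀₀₀)))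
      where
      v⊥ : ∀ w → form (blockDiag L) v w ≡ + 0 mod 4
      v⊥ w = ≡mod-trans (≡mod-sym (⟨⟩≡form-mod4 A (blockDiag L) A≡L v w)) (∣⇒≡0mod (v∈V₀₀₀ w))

    mask₀₀₀⇒V̄₀₀₀ : ∀ {x} → SupportedOn (mask₀₀₀ L) x → V̄₀₀₀ x
    mask₀₀₀⇒V̄₀₀₀ {x} x∈M = lift x , (≡0mod⇒∣ ∘ ≡mod*⇒≡mod {2} {2} ∘ lift-x⊥ , ≡0mod⇒∣ ∘ lift-x⊥) , red-ι ∘ x
      where
      lift-x⊥ : ∀ w → ⟨ lift x , w ⟩ ≡ + 0 mod 4
      lift-x⊥ w = ≡mod-trans (⟨⟩≡form-mod4 A (blockDiag L) A≡L (lift x) w) (≡mod-reflexive (mask₀₀₀-form≡0 L x x∈M w))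

    V̄₀₀₀⇒V̄₀ : ∀ {x} → V̄₀₀₀ x → V̄₀ x
    V̄₀₀₀⇒V̄₀ (v , (v∈V₀ , _) , red-v≈x) = v , v∈V₀ , red-v≈x

    mask₀₀₀⇒mask₀ : ∀ {x} → SupportedOn (mask₀₀₀ L) x → SupportedOn (mask₀ L) x
    mask₀₀₀⇒mask₀ = V̄₀⇒mask₀ ∘ V̄₀₀₀⇒V̄₀ ∘ mask₀₀₀⇒V̄₀₀₀

    dim-V̄₀ : IsDim V̄₀ (count (mask₀ L))
    dim-V̄₀ = let b , basis = coordinateBasis (mask₀ L) in b , Basis-transfer mask₀⇒V̄₀ V̄₀⇒mask₀ basis

    dim-V̄₀₀₀ : IsDim V̄₀₀₀ (count (mask₀₀₀ L))
    dim-V̄₀₀₀ = let b , basis = coordinateBasis (mask₀₀₀ L) in b , Basis-transfer mask₀₀₀⇒V̄₀₀₀ V̄₀₀₀⇒mask₀₀₀ basis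

    dim-V̄₀/V̄₀₀₀ : ∀ d → IsQuotDim V̄₀ V̄₀₀₀ d → d ℕ.+ count (mask₀₀₀ L) ≡ count (mask₀ L)
    dim-V̄₀/V̄₀₀₀ d (bq , quotient-basis) = basis-size-unique
      (QuotientBasis-++ (λ _ → mask₀₀₀⇒mask₀)
                        (QuotientBasis-transfer {W = V̄₀} {SupportedOn (mask₀ L)} {V̄₀₀₀} {SupportedOn (mask₀₀₀ L)}
                                                V̄₀⇒mask₀ mask₀⇒V̄₀ V̄₀₀₀⇒mask₀₀₀ mask₀₀₀⇒V̄₀₀₀ quotient-basis)
                        (proj₂ (coordinateBasis (mask₀₀₀ L))))
      (proj₂ (coordinateBasis (mask₀ L)))

  sum-replicate : ∀ n x → sum (replicate n x) ≡ n ℕ.* x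
  sum-replicate zero    x = refl
  sum-replicate (suc n) x = cong (x ℕ.+_) (sum-replicate n x)

  sum-map-layout : ∀ (g : Block → ℕ) r s t p m →
                   sum (map g (layout r s t p m)) ≡ r ℕ.* g B21 ℕ.+ (s ℕ.* g B01 ℕ.+ (t ℕ.* g B02 ℕ.+ (p ℕ.* g One2 ℕ.+ m ℕ.* g One0)))
  sum-map-layout g r s t p m =
    trans (split (replicate r B21) _) (cong₂ ℕ._+_ (part r B21)
    (trans (split (replicate s B01) _) (cong₂ ℕ._+_ (part s B01)
    (trans (split (replicate t B02) _) (cong₂ ℕ._+_ (part t B02)
    (trans (split (replicate p One2) _) (cong₂ ℕ._+_ (part p One2) (part m One0))))))))
    where
    split : ∀ xs ys → sum (map g (xs ++ ys)) ≡ sum (map g xs) ℕ.+ sum (map g ys)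
    split xs ys = trans (cong sum (map-++ g xs ys)) (sum-++ (map g xs) (map g ys))
    part : ∀ n b → sum (map g (replicate n b)) ≡ n ℕ.* g b
    part n b = trans (cong sum (map-replicate g n b)) (sum-replicate n (g b))

  count-mask₀-layout : ∀ r s t p m → count (mask₀ (layout r s t p m)) ≡ 2 ℕ.* t ℕ.+ p ℕ.+ m
  count-mask₀-layout r s t p m = trans (count-blockwise blockMask₀ (layout r s t p m))
    (trans (sum-map-layout (count ∘ blockMask₀) r s t p m) (arithmetic r s t p m))
    where
    arithmetic : ∀ r s t p m → r ℕ.* 0 ℕ.+ (s ℕ.* 0 ℕ.+ (t ℕ.* 2 ℕ.+ (p ℕ.* 1 ℕ.+ m ℕ.* 1))) ≡ 2 ℕ.* t ℕ.+ p ℕ.+ m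
    arithmetic = ℕ-Solver.solve-∀

  count-mask₀₀₀-layout : ∀ r s t p m → count (mask₀₀₀ (layout r s t p m)) ≡ m
  count-mask₀₀₀-layout r s t p m = trans (count-blockwise blockMask₀₀₀ (layout r s t p m))
    (trans (sum-map-layout (count ∘ blockMask₀₀₀) r s t p m) (arithmetic r s t p m))
    where
    arithmetic : ∀ r s t p m → r ℕ.* 0 ℕ.+ (s ℕ.* 0 ℕ.+ (t ℕ.* 0 ℕ.+ (p ℕ.* 0 ℕ.+ m ℕ.* 1))) ≡ m
    arithmetic = ℕ-Solver.solve-∀

  gaussFactor : List Block → ℤ
  gaussFactor []      = + 1
  gaussFactor (b ∷ L) = gauss (blockq b) * gaussFactor L

  gauss-q[] : ∀ L → gauss q[ L ] ≡ gaussFactor L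
  gauss-q[] []      = refl
  gauss-q[] (b ∷ L) = begin
    sumBits (sg ∘ q[ b ∷ L ])
      ≡⟨ sumBits-++ (bsize b) (sg ∘ q[ b ∷ L ]) (cong sg ∘ Q-cong) ⟩
    sumBits {bsize b} (λ u → sumBits {size L} (λ w → sg (q[ b ∷ L ] (u VF.++ w))))
      ≡⟨ sumBits-cong (λ u → sumBits-cong (λ w → trans (cong sg (split u w)) (sg-xor (blockq b u) (q[ L ] w)))) ⟩
    sumBits {bsize b} (λ u → sumBits {size L} (λ w → sg (blockq b u) * sg (q[ L ] w)))
      ≡⟨ sumBits-cong (λ u → sumBits-*ˡ (sg (blockq b u)) (sg ∘ q[ L ])) ⟩
    sumBits {bsize b} (λ u → sg (blockq b u) * gauss q[ L ])
      ≡⟨ sumBits-*ʳ (sg ∘ blockq b) (gauss q[ L ]) ⟩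
    gauss (blockq b) * gauss q[ L ]
      ≡⟨ cong (gauss (blockq b) *_) (gauss-q[] L) ⟩
    gaussFactor (b ∷ L) ∎
    where
    open ≡-Reasoning
    open IsQuadraticForm (q[]-isQuadraticForm (b ∷ L)) using (Q-cong)
    open IsQuadraticForm (q[]-isQuadraticForm L) using () renaming (Q-cong to Q-congᴸ)
    split : ∀ u w → q[ b ∷ L ] (u VF.++ w) ≡ blockq b u xor q[ L ] w
    split u w = cong₂ _xor_ (blockq-cong b (lookup-++ˡ u w)) (Q-congᴸ (lookup-++ʳ u w))

  gaussFactor-++ : ∀ L₁ L₂ → gaussFactor (L₁ ++ L₂) ≡ gaussFactor L₁ * gaussFactor L₂
  gaussFactor-++ []       L₂ = sym (ℤ.*-identityˡ _)
  gaussFactor-++ (b ∷ L₁) L₂ = trans (cong (gauss (blockq b) *_) (gaussFactor-++ L₁ L₂)) (sym (ℤ.*-assoc (gauss (blockq b)) _ _))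

  gaussFactor-replicate : ∀ n b → gaussFactor (replicate n b) ≡ gauss (blockq b) ^ n
  gaussFactor-replicate zero    b = refl
  gaussFactor-replicate (suc n) b = cong (gauss (blockq b) *_) (gaussFactor-replicate n b)

  gaussFactor-layout : ∀ r s t p m →
    gaussFactor (layout r s t p m) ≡ (- + 2) ^ r * ((+ 2) ^ s * ((+ 4) ^ t * ((+ 0) ^ p * (+ 2) ^ m)))
  gaussFactor-layout r s t p m =
    trans (gaussFactor-++ (replicate r B21) _) (cong₂ _*_ (gaussFactor-replicate r B21)
    (trans (gaussFactor-++ (replicate s B01) _) (cong₂ _*_ (gaussFactor-replicate s B01)
    (trans (gaussFactor-++ (replicate t B02) _) (cong₂ _*_ (gaussFactor-replicate t B02)
    (trans (gaussFactor-++ (replicate p One2) _) (cong₂ _*_ (gaussFactor-replicate p One2) (gaussFactor-replicate m One0))))))))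

  pos-^ : ∀ a n → (+ a) ^ n ≡ + (a ℕ.^ n)
  pos-^ a zero    = refl
  pos-^ a (suc n) = trans (cong (+ a *_) (pos-^ a n)) (sym (ℤ.pos-* a (a ℕ.^ n)))

  [-2]^≡ : ∀ n → (- + 2) ^ n ≡ sg (odd n) * + (2 ℕ.^ n)
  [-2]^≡ 0             = refl
  [-2]^≡ 1             = refl
  [-2]^≡ (suc (suc n)) = begin
    - + 2 * (- + 2 * (- + 2) ^ n)              ≡⟨ cong (λ x → - + 2 * (- + 2 * x)) ([-2]^≡ n) ⟩
    - + 2 * (- + 2 * (sg (odd n) * + 2ⁿ))       ≡⟨ regroup (sg (odd n)) (+ 2ⁿ) ⟩
    sg (odd n) * (+ 2 * (+ 2 * + 2ⁿ))           ≡⟨ cong (λ x → sg (odd n) * (+ 2 * x)) (ℤ.pos-* 2 2ⁿ) ⟨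
    sg (odd n) * (+ 2 * + (2 ℕ.* 2ⁿ))           ≡⟨ cong (sg (odd n) *_) (ℤ.pos-* 2 (2 ℕ.* 2ⁿ)) ⟨
    sg (odd n) * + (2 ℕ.^ suc (suc n))          ∎
    where
    open ≡-Reasoning
    2ⁿ = 2 ℕ.^ n
    regroup : ∀ S P → - + 2 * (- + 2 * (S * P)) ≡ S * (+ 2 * (+ 2 * P))
    regroup = solve-∀

  sg-*≢0 : ∀ a {N} .{{_ : NonZero N}} → sg a * + N ≢ + 0
  sg-*≢0 false {suc N} ()
  sg-*≢0 true  {suc N} ()

  sg-*-injective : ∀ a b {M N} .{{_ : NonZero M}} .{{_ : NonZero N}} → sg a * + M ≡ sg b * + N → a ≡ b
  sg-*-injective false false _ = refl
  sg-*-injective true  true  _ = refl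
  sg-*-injective false true  {suc M} {suc N} ()
  sg-*-injective true  false {suc M} {suc N} ()

  sg-factor : ∀ u a b → + a * (+ b * sg u) ≡ sg u * + (a ℕ.* b)
  sg-factor u a b = trans (regroup (+ a) (+ b) (sg u)) (cong (sg u *_) (sym (ℤ.pos-* a b)))
    where
    regroup : ∀ a b c → a * (b * c) ≡ c * (a * b)
    regroup = solve-∀

  -- A (2) block makes the Gauss sum vanish; otherwise its sign is (-1)^r.
  parity-from-gauss : ∀ r s t p m u k l →
    (- + 2) ^ r * ((+ 2) ^ s * ((+ 4) ^ t * ((+ 0) ^ p * (+ 2) ^ m))) ≡ + (2 ℕ.^ l) * (+ (2 ℕ.^ k) * sg u) →
    r % 2 ≡ bit u
  parity-from-gauss r s t (suc p) m u k l eq =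
    contradiction {A = sg u * + (2 ℕ.^ l ℕ.* 2 ℕ.^ k) ≡ + 0}
      (trans (sym (sg-factor u (2 ℕ.^ l) (2 ℕ.^ k)))
             (trans (sym eq) (vanish ((- + 2) ^ r) ((+ 2) ^ s) ((+ 4) ^ t) ((+ 0) ^ p) ((+ 2) ^ m))))
      (sg-*≢0 u {2 ℕ.^ l ℕ.* 2 ℕ.^ k})
    where
    instance
      _ = ℕ.m*n≢0 (2 ℕ.^ l) (2 ℕ.^ k) {{ℕ.m^n≢0 2 l}} {{ℕ.m^n≢0 2 k}}
    vanish : ∀ a b c d e → a * (b * (c * (+ 0 * d * e))) ≡ + 0
    vanish = solve-∀
  parity-from-gauss r s t zero m u k l eq =
    trans (%2≡bit∘odd r) (cong bit (sg-*-injective (odd r) u {N} {2 ℕ.^ l ℕ.* 2 ℕ.^ k}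
      (trans (sym block-side) (trans eq (sg-factor u (2 ℕ.^ l) (2 ℕ.^ k))))))
    where
    N = 2 ℕ.^ r ℕ.* (2 ℕ.^ s ℕ.* (4 ℕ.^ t ℕ.* 2 ℕ.^ m))
    instance
      _ = ℕ.m*n≢0 (2 ℕ.^ l) (2 ℕ.^ k) {{ℕ.m^n≢0 2 l}} {{ℕ.m^n≢0 2 k}}
      _ : NonZero N
      _ = ℕ.m*n≢0 (2 ℕ.^ r) _ {{ℕ.m^n≢0 2 r}}
            {{ℕ.m*n≢0 (2 ℕ.^ s) _ {{ℕ.m^n≢0 2 s}} {{ℕ.m*n≢0 (4 ℕ.^ t) (2 ℕ.^ m) {{ℕ.m^n≢0 4 t}} {{ℕ.m^n≢0 2 m}}}}}}
    block-side : (- + 2) ^ r * ((+ 2) ^ s * ((+ 4) ^ t * (+ 1 * (+ 2) ^ m))) ≡ sg (odd r) * + N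
    block-side = begin
      (- + 2) ^ r * ((+ 2) ^ s * ((+ 4) ^ t * (+ 1 * (+ 2) ^ m)))
        ≡⟨ cong₂ _*_ ([-2]^≡ r) (cong₂ _*_ (pos-^ 2 s) (cong₂ _*_ (pos-^ 4 t) (cong (+ 1 *_) (pos-^ 2 m)))) ⟩
      sg (odd r) * + (2 ℕ.^ r) * (+ (2 ℕ.^ s) * (+ (4 ℕ.^ t) * (+ 1 * + (2 ℕ.^ m))))
        ≡⟨ regroup (sg (odd r)) (+ (2 ℕ.^ r)) (+ (2 ℕ.^ s)) (+ (4 ℕ.^ t)) (+ (2 ℕ.^ m)) ⟩
      sg (odd r) * (+ (2 ℕ.^ r) * (+ (2 ℕ.^ s) * (+ (4 ℕ.^ t) * + (2 ℕ.^ m))))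
        ≡⟨ cong (sg (odd r) *_) (trans (cong (λ x → + (2 ℕ.^ r) * (+ (2 ℕ.^ s) * x)) (sym (ℤ.pos-* (4 ℕ.^ t) (2 ℕ.^ m))))
                                  (trans (cong (+ (2 ℕ.^ r) *_) (sym (ℤ.pos-* (2 ℕ.^ s) _))) (sym (ℤ.pos-* (2 ℕ.^ r) _)))) ⟩
      sg (odd r) * + N ∎
      where
      open ≡-Reasoning
      regroup : ∀ S a b c d → S * a * (b * (c * (+ 1 * d))) ≡ S * (a * (b * (c * d)))
      regroup = solve-∀

  module Layout (r s t p m : ℕ) (A : Matrix ℤ (size (layout r s t p m)))
                (A≡L : ∀ i j → (A mod4) i j ≡ blockDiag (layout r s t p m) i j) where
    open Lattice A hiding (lift)
    private
      L = layout r s t p m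
    open NormalForm L A A≡L

    dim-V̄₀-layout : IsDim V̄₀ (2 ℕ.* t ℕ.+ p ℕ.+ m)
    dim-V̄₀-layout = subst (IsDim V̄₀) (count-mask₀-layout r s t p m) dim-V̄₀

    dim-V̄₀₀₀-layout : IsDim V̄₀₀₀ m
    dim-V̄₀₀₀-layout = subst (IsDim V̄₀₀₀) (count-mask₀₀₀-layout r s t p m) dim-V̄₀₀₀

    quotient-parity : ∀ d → IsQuotDim V̄₀ V̄₀₀₀ d → p % 2 ≡ d % 2
    quotient-parity d quotient = begin
      p % 2                   ≡⟨ ℕ.[m+kn]%n≡m%n p t 2 ⟨
      (p ℕ.+ t ℕ.* 2) % 2     ≡⟨ cong (_% 2) (trans (ℕ.+-comm p _) (cong (ℕ._+ p) (ℕ.*-comm t 2))) ⟩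
      (2 ℕ.* t ℕ.+ p) % 2     ≡⟨ cong (_% 2) d≡2t+p ⟨
      d % 2                   ∎
      where
      open ≡-Reasoning
      d≡2t+p : d ≡ 2 ℕ.* t ℕ.+ p
      d≡2t+p = ℕ.+-cancelʳ-≡ m d _ (begin
        d ℕ.+ m                              ≡⟨ cong (d ℕ.+_) (count-mask₀₀₀-layout r s t p m) ⟨
        d ℕ.+ count (mask₀₀₀ L)              ≡⟨ dim-V̄₀/V̄₀₀₀ d quotient ⟩
        count (mask₀ L)                      ≡⟨ count-mask₀-layout r s t p m ⟩
        2 ℕ.* t ℕ.+ p ℕ.+ m                  ∎)

    arf-parity : (∀ x → V̄₀ x → q x ≡ 0) → ∀ {k l} (e f : Fin k → V̄) (h : Fin l → V̄) →
                 SymplecticBasis e f h → r % 2 ≡ arfSum e f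
    arf-parity q[V̄₀]≡0 {k} {l} e f h (basis , _ , _ , fe≡1 , fe≢0 , ee≡0 , ff≡0 , _ , he≡0 , _ , hf≡0 , hh≡0) =
      trans (parity-from-gauss r s t p m arf k l gauss-sums) (sym arfSum≡arf)
      where
      open QuadraticForm (q[]-isQuadraticForm L)
      arf = sum𝔽₂ (λ i → q[ L ] (e i) ∧ q[ L ] (f i))
      Ω≡0 : ∀ {x y} → Ω x y ≡ 0 → Ω[ L ] x y ≡ false
      Ω≡0 {x} {y} Ωxy≡0 = bit≡0⇒false (trans (sym (Ω≡Ω[] x y)) Ωxy≡0)
      symplectic : IsSymplecticBasis e f h
      symplectic = record
        { basis  = basis
        ; B-ee   = λ i j → Ω≡0 (ee≡0 i j)
        ; B-ff   = λ i j → Ω≡0 (ff≡0 i j)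
        ; B-fe-≡ = λ i j i≡j → bit≡1⇒true (trans (sym (Ω≡Ω[] (f i) (e j))) (fe≡1 i j i≡j))
        ; B-fe-≢ = λ i j i≢j → Ω≡0 (fe≢0 i j i≢j)
        ; B-he   = λ i j → Ω≡0 (he≡0 i j)
        ; B-hf   = λ i j → Ω≡0 (hf≡0 i j)
        ; B-hh   = λ i j → Ω≡0 (hh≡0 i j)
        }
      q-radical : ∀ x → (∀ y → Ω[ L ] x y ≡ false) → q[ L ] x ≡ false
      q-radical x x⊥ = bit≡0⇒false (trans (sym (q≡q[] x))
                         (q[V̄₀]≡0 x (radical⇒V̄₀ A (λ y → trans (Ω≡Ω[] x y) (cong bit (x⊥ y))))))
      gauss-sums : (- + 2) ^ r * ((+ 2) ^ s * ((+ 4) ^ t * ((+ 0) ^ p * (+ 2) ^ m))) ≡ + (2 ℕ.^ l) * (+ (2 ℕ.^ k) * sg arf)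
      gauss-sums = trans (sym (gaussFactor-layout r s t p m))
                         (trans (sym (gauss-q[] L)) (Symplectic.gauss-symplectic symplectic q-radical))
      arfSum≡arf : arfSum e f ≡ bit arf
      arfSum≡arf = trans (cong (_% 2) (sumℕ-cong λ i →
                     trans (cong₂ ℕ._*_ (q≡q[] (e i)) (q≡q[] (f i))) (bit-∧ (q[ L ] (e i)) (q[ L ] (f i)))))
                         (sumℕ-bit-%2 (λ i → q[ L ] (e i) ∧ q[ L ] (f i)))

open BlockDiagonalForms using (module Layout)

open import Defs
open import Data.Nat using (ℕ; _+_; _*_; _%_)
open import Data.Integer using (ℤ)
open import Data.Fin using (Fin)
open import Data.Product using (_×_; _,_)
open import Relation.Binary.PropositionalEquality using (_≡_)

lemma2p8 : (r s t p m : ℕ) (A : Matrix ℤ (size (layout r s t p m)))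
    → Symmetric A
    → EvenDiagonal A
    → (∀ i j → (A mod4) i j ≡ blockDiag (layout r s t p m) i j)
    → let open Lattice A in
      IsDim V̄₀₀₀ m
      × IsDim V̄₀ (2 * t + p + m)
      × (∀ d → IsQuotDim V̄₀ V̄₀₀₀ d → p % 2 ≡ d % 2)
      × ((∀ x → V̄₀ x → q x ≡ 0)
         → ∀ {k l} (e f : Fin k → V̄) (h : Fin l → V̄)
         → SymplecticBasis e f h
         → r % 2 ≡ arfSum e f)
lemma2p8 r s t p m A _ _ A≡L = dim-V̄₀₀₀-layout , dim-V̄₀-layout , quotient-parity , arf-parity
  where open Layout r s t p m A A≡L
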